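{- Let $n\ge 2$ be an integer and let $\zeta$ be a primitive $n$th root of unity. Then \[ \sum_{\substack{1\le k\le n\\ (n,k)=1}}\frac{\zeta^k}{(1-\zeta^k)^2}=-\frac{J_2(n)}{12}, \] where $J_2(n)=\sum_{d\mid n}\mu(n/d)\,d^2$ is the Jordan totient function of order $2$ and $\mu$ is the Möbius function.
   Context: $(n,k)$ denotes the greatest common divisor of $n$ and $k$. The Jordan totient function $J_2(n)$ is the number of pairs $(a,b)$ of positive integers with $a,b\le n$ such that $\gcd(a,b,n)=1$; equivalently $J_2(n)=\sum_{d\mid n}\mu(n/d)d^2$. -}

module Defs where

open import Level using (Level; _⊔_) renaming (suc to lsuc)
open import Data.Nat as ℕ using (ℕ; zero; suc)
open import Data.Nat.Divisibility using (_∣?_)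
open import Data.Nat.Primality using (prime?)
open import Data.Nat.GCD using (gcd)
open import Data.Integer as ℤ using (ℤ; +_; -[1+_])
open import Data.List using (List; []; _∷_; filter; map; foldr; length; upTo)
open import Data.Product using () renaming (_×_ to _P×_)
open import Relation.Nullary using (¬_; Dec; yes; no)
open import Relation.Nullary.Decidable using (_×-dec_)
open import Algebra.Bundles using (CommutativeRing; Semiring)
import Algebra.Definitions.RawSemiring as RS

range1 : ℕ → List ℕ
range1 n = map suc (upTo n)

hasSquareFactor : ℕ → List ℕ
hasSquareFactor n = filter (λ k → (2 ℕ.≤? k) ×-dec ((k ℕ.* k) ∣? n)) (range1 n)

primeDivisors : ℕ → List ℕ
primeDivisors n = filter (λ p → prime? p ×-dec (p ∣? n)) (range1 n)

negOnePow : ℕ → ℤ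
negOnePow zero = + 1
negOnePow (suc m) = ℤ.- negOnePow m

μ : ℕ → ℤ
μ zero = + 0
μ n@(suc _) with hasSquareFactor n
... | [] = negOnePow (length (primeDivisors n))
... | _ ∷ _ = + 0

divisors : ℕ → List ℕ
divisors n = filter (λ d → d ∣? n) (range1 n)

quot : ℕ → ℕ → ℕ
quot n zero = 0
quot n (suc d) = n ℕ./ suc d

J₂ : ℕ → ℤ
J₂ n = foldr ℤ._+_ (+ 0)
  (map (λ d → μ (quot n d) ℤ.* (+ (d ℕ.* d))) (divisors n))

record Field (c ℓ : Level) : Set (lsuc (c ⊔ ℓ)) where
  field
    commutativeRing : CommutativeRing c ℓ
  open CommutativeRing commutativeRing public
  open RS (Semiring.rawSemiring semiring) public using (_^_; _×_)
  field
    _⁻¹ : Carrier → Carrier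
    0≉1 : ¬ (0# ≈ 1#)
    inverseʳ : ∀ x → ¬ (x ≈ 0#) → x * (x ⁻¹) ≈ 1#

  _÷_ : Carrier → Carrier → Carrier
  x ÷ y = x * (y ⁻¹)

  fromℤ : ℤ → Carrier
  fromℤ (+ n) = n × 1#
  fromℤ -[1+ n ] = - (suc n × 1#)

  sumL : (ℕ → Carrier) → List ℕ → Carrier
  sumL f = foldr (λ k acc → f k + acc) 0#

  CharZero : Set ℓ
  CharZero = ∀ m → ¬ (suc m × 1# ≈ 0#)

  IsPrimitiveRoot : ℕ → Carrier → Set ℓ
  IsPrimitiveRoot n ζ = (ζ ^ n ≈ 1#) P× (∀ k → 1 ℕ.≤ k → k ℕ.< n → ¬ (ζ ^ k ≈ 1#))

coprimeIndices : ℕ → List ℕ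
coprimeIndices n = filter (λ k → gcd n k ℕ.≟ 1) (range1 n)

{-# OPTIONS --safe #-}
module Submission where

-- Möbius inversion over gcd(n, k) writes the sum over k coprime to n as Σ_{e ∣ n} μ(e) S(n/e), where
-- S(m) is the sum of x/(1-x)² over the nontrivial m-th roots of unity x, here the powers of ζ^e.
-- For such x the closed forms of Σ_{j<m} xʲ, Σ j xʲ and Σ j² xʲ give 2m·x/(1-x)² = m Σ j xʲ − Σ j² xʲ;
-- summed over all nontrivial x, every xʲ with 0 < j < m contributes −1, so Faulhaber's formulas
-- for Σ j and Σ j² give 12 S(m) = −(m² − 1). Finally Σ_{e ∣ n} μ(e)((n/e)² − 1) = J₂(n) − [n = 1].

open import Defs
open import Level using (Level)
open import Function using (_∘_)
open import Data.Nat as ℕ using (ℕ; zero; suc; _≤_; _<_; z≤n; s≤s)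
import Data.Nat.Properties as ℕP
open import Data.Nat.Divisibility
import Data.Nat.DivMod as DM
open import Data.Nat.Primality using (Prime; prime?; euclidsLemma; prime⇒irreducible; prime⇒nonZero; prime⇒nonTrivial)
open import Data.Nat.Primality.Factorisation using (factorise)
open import Data.Nat.Coprimality using (Coprime; coprime-divisor)
open import Data.Nat.GCD using (gcd; gcd[m,n]∣m; gcd[m,n]∣n; gcd-greatest; gcd[m,n]≢0)
open import Data.Integer as ℤ using (ℤ; +_; -[1+_]; _⊖_)
import Data.Integer.Properties as ℤP
open import Data.Integer.Tactic.RingSolver using (solve-∀)
open import Data.List using (List; []; _∷_; filter; map; foldr; length; upTo; applyUpTo)
open import Data.List.Properties using (filter-none; foldr-map)
open import Data.List.Membership.Propositional using (_∈_)
open import Data.List.Membership.Propositional.Properties using (∈-map⁺; ∈-upTo⁺; ∈-filter⁺; ∈-filter⁻)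
open import Data.List.Relation.Unary.Any using (here)
open import Data.List.Relation.Unary.All as All using (_∷_)
open import Data.Maybe using (Maybe; just; nothing)
open import Data.Product using (_,_; ∃-syntax; proj₁; proj₂) renaming (_×_ to _P×_)
open import Data.Sum using (_⊎_; inj₁; inj₂; [_,_]′)
open import Data.Empty using (⊥-elim)
open import Relation.Binary.PropositionalEquality as ≡ using (_≡_; _≢_)
open import Relation.Nullary using (¬_; Dec; yes; no; ¬?; contradiction)
open import Relation.Nullary.Decidable using (_×-dec_)
open import Relation.Unary using (Decidable)
open import Algebra.Bundles using (CommutativeMonoid; CommutativeRing)
import Algebra.Properties.CommutativeSemigroup as CommSemigroupProperties
import Algebra.Solver.Ring.AlmostCommutativeRing as ACR
import Algebra.Solver.Ring
import Relation.Binary.Reasoning.Setoid as SetoidReasoning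

module RangeSum {c ℓ} (M : CommutativeMonoid c ℓ) where
  open CommutativeMonoid M renaming (_∙_ to _+_; ε to 0#; identityˡ to +-identityˡ;
    identityʳ to +-identityʳ; ∙-cong to +-cong; ∙-congˡ to +-congˡ; ∙-congʳ to +-congʳ; assoc to +-assoc)
  open SetoidReasoning setoid
  open CommSemigroupProperties commutativeSemigroup using (interchange)

  infixr 9 ∑< ∑≤

  ∑< : ℕ → (ℕ → Carrier) → Carrier
  ∑< zero f = 0#
  ∑< (suc n) f = ∑< n f + f n

  syntax ∑< n (λ i → x) = ∑[ i < n ] x

  ∑≤ : ℕ → (ℕ → Carrier) → Carrier
  ∑≤ zero f = 0#
  ∑≤ (suc n) f = ∑≤ n f + f (suc n)

  syntax ∑≤ n (λ k → x) = ∑[1≤ k ≤ n ] x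

  ∑<-cong : ∀ n {f g : ℕ → Carrier} → (∀ i → i < n → f i ≈ g i) → ∑< n f ≈ ∑< n g
  ∑<-cong zero h = refl
  ∑<-cong (suc n) h = +-cong (∑<-cong n (λ i i<n → h i (ℕP.m<n⇒m<1+n i<n))) (h n ℕP.≤-refl)

  ∑<-zero : ∀ n {f : ℕ → Carrier} → (∀ i → i < n → f i ≈ 0#) → ∑< n f ≈ 0#
  ∑<-zero zero h = refl
  ∑<-zero (suc n) h = trans (+-cong (∑<-zero n (λ i i<n → h i (ℕP.m<n⇒m<1+n i<n))) (h n ℕP.≤-refl)) (+-identityˡ 0#)

  ∑<-distrib-+ : ∀ n (f g : ℕ → Carrier) → ∑[ i < n ] (f i + g i) ≈ ∑< n f + ∑< n g
  ∑<-distrib-+ zero f g = sym (+-identityˡ 0#)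
  ∑<-distrib-+ (suc n) f g = trans (+-congʳ (∑<-distrib-+ n f g)) (interchange _ _ _ _)

  ∑<-cons : ∀ n (f : ℕ → Carrier) → ∑< (suc n) f ≈ f 0 + ∑[ i < n ] f (suc i)
  ∑<-cons zero f = trans (+-identityˡ _) (sym (+-identityʳ _))
  ∑<-cons (suc n) f = trans (+-congʳ (∑<-cons n f)) (+-assoc _ _ _)

  ∑≤-as-∑< : ∀ n f → ∑≤ n f ≈ ∑[ i < n ] f (suc i)
  ∑≤-as-∑< zero f = refl
  ∑≤-as-∑< (suc n) f = +-congʳ (∑≤-as-∑< n f)

  ∑≤-cong : ∀ n {f g : ℕ → Carrier} → (∀ k → 1 ≤ k → k ≤ n → f k ≈ g k) → ∑≤ n f ≈ ∑≤ n g
  ∑≤-cong zero h = refl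
  ∑≤-cong (suc n) h = +-cong (∑≤-cong n (λ k 1≤k k≤n → h k 1≤k (ℕP.m≤n⇒m≤1+n k≤n))) (h (suc n) (s≤s z≤n) ℕP.≤-refl)

  ∑≤-zero : ∀ n {f : ℕ → Carrier} → (∀ k → 1 ≤ k → k ≤ n → f k ≈ 0#) → ∑≤ n f ≈ 0#
  ∑≤-zero zero h = refl
  ∑≤-zero (suc n) h =
    trans (+-cong (∑≤-zero n (λ k 1≤k k≤n → h k 1≤k (ℕP.m≤n⇒m≤1+n k≤n))) (h (suc n) (s≤s z≤n) ℕP.≤-refl)) (+-identityˡ 0#)

  ∑≤-distrib-+ : ∀ n (f g : ℕ → Carrier) → ∑[1≤ k ≤ n ] (f k + g k) ≈ ∑≤ n f + ∑≤ n g
  ∑≤-distrib-+ zero f g = sym (+-identityˡ 0#)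
  ∑≤-distrib-+ (suc n) f g = trans (+-congʳ (∑≤-distrib-+ n f g)) (interchange _ _ _ _)

  ∑≤-comm : ∀ m n (f : ℕ → ℕ → Carrier) → ∑[1≤ i ≤ m ] ∑[1≤ j ≤ n ] f i j ≈ ∑[1≤ j ≤ n ] ∑[1≤ i ≤ m ] f i j
  ∑≤-comm zero n f = sym (∑≤-zero n (λ _ _ _ → refl))
  ∑≤-comm (suc m) n f = trans (+-congʳ (∑≤-comm m n f)) (sym (∑≤-distrib-+ n _ _))

  ∑≤-∑<-comm : ∀ m n (f : ℕ → ℕ → Carrier) → ∑[1≤ i ≤ m ] ∑[ j < n ] f i j ≈ ∑[ j < n ] ∑[1≤ i ≤ m ] f i j
  ∑≤-∑<-comm zero n f = sym (∑<-zero n (λ _ _ → refl))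
  ∑≤-∑<-comm (suc m) n f = trans (+-congʳ (∑≤-∑<-comm m n f)) (sym (∑<-distrib-+ n _ _))

  ∑≤-split : ∀ a b (f : ℕ → Carrier) → ∑≤ (a ℕ.+ b) f ≈ ∑≤ a f + ∑[1≤ i ≤ b ] f (a ℕ.+ i)
  ∑≤-split a zero f rewrite ℕP.+-identityʳ a = sym (+-identityʳ _)
  ∑≤-split a (suc b) f rewrite ℕP.+-suc a b = trans (+-congʳ (∑≤-split a b f)) (+-assoc _ _ _)

  ∑≤-single : ∀ n c {f : ℕ → Carrier} → 1 ≤ c → c ≤ n → (∀ k → 1 ≤ k → k ≤ n → k ≢ c → f k ≈ 0#) → ∑≤ n f ≈ f c
  ∑≤-single zero (suc _) _ () _
  ∑≤-single (suc n) c 1≤c c≤1+n h with c ℕ.≟ suc n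
  ... | yes ≡.refl =
    trans (+-congʳ (∑≤-zero n (λ k 1≤k k≤n → h k 1≤k (ℕP.m≤n⇒m≤1+n k≤n) (ℕP.<⇒≢ (s≤s k≤n))))) (+-identityˡ _)
  ... | no c≢1+n =
    trans (+-cong (∑≤-single n c 1≤c (ℕP.≤-pred (ℕP.≤∧≢⇒< c≤1+n c≢1+n)) (λ k 1≤k k≤n → h k 1≤k (ℕP.m≤n⇒m≤1+n k≤n)))
                  (h (suc n) (s≤s z≤n) ℕP.≤-refl (c≢1+n ∘ ≡.sym)))
          (+-identityʳ _)

  ∑≤-extend : ∀ {a b} {f : ℕ → Carrier} → a ≤ b → (∀ k → a < k → k ≤ b → f k ≈ 0#) → ∑≤ b f ≈ ∑≤ a f
  ∑≤-extend {a} {f = f} a≤b h with ℕP.m≤n⇒∃[o]m+o≡n a≤b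
  ... | o , ≡.refl = trans (∑≤-split a o f)
                       (trans (+-congˡ (∑≤-zero o (λ i 1≤i i≤o → h (a ℕ.+ i) (ℕP.m<m+n a 1≤i) (ℕP.+-monoʳ-≤ a i≤o))))
                              (+-identityʳ _))

  infixr 9 𝟙[_]_

  𝟙[_]_ : ∀ {p} {P : Set p} → Dec P → Carrier → Carrier
  𝟙[ yes _ ] x = x
  𝟙[ no _ ] x = 0#

  𝟙-yes : ∀ {p} {P : Set p} (P? : Dec P) {x} → P → 𝟙[ P? ] x ≈ x
  𝟙-yes (yes _) _ = refl
  𝟙-yes (no ¬p) p = ⊥-elim (¬p p)

  𝟙-no : ∀ {p} {P : Set p} (P? : Dec P) {x} → ¬ P → 𝟙[ P? ] x ≈ 0#
  𝟙-no (yes p) ¬p = ⊥-elim (¬p p)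
  𝟙-no (no _) _ = refl

  𝟙-cong : ∀ {p} {P : Set p} (P? : Dec P) {x y} → (P → x ≈ y) → 𝟙[ P? ] x ≈ 𝟙[ P? ] y
  𝟙-cong (yes p) x≈y = x≈y p
  𝟙-cong (no _) _ = refl

  𝟙-split : ∀ {p} {P : Set p} (P? : Dec P) x → x ≈ 𝟙[ P? ] x + 𝟙[ ¬? P? ] x
  𝟙-split (yes _) x = sym (+-identityʳ x)
  𝟙-split (no _) x = sym (+-identityˡ x)

  ∑≤-𝟙 : ∀ {p} {P : Set p} (P? : Dec P) n (f : ℕ → Carrier) → ∑[1≤ k ≤ n ] 𝟙[ P? ] f k ≈ 𝟙[ P? ] ∑≤ n f
  ∑≤-𝟙 (yes _) n f = refl
  ∑≤-𝟙 (no _) n f = ∑≤-zero n (λ _ _ _ → refl)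

  𝟙-⇔ : ∀ {p q} {P : Set p} {Q : Set q} (P? : Dec P) (Q? : Dec Q) {x} → (P → Q) → (Q → P) → 𝟙[ P? ] x ≈ 𝟙[ Q? ] x
  𝟙-⇔ (yes _) (yes _) _ _ = refl
  𝟙-⇔ (yes p) (no ¬q) f _ = ⊥-elim (¬q (f p))
  𝟙-⇔ (no ¬p) (yes q) _ g = ⊥-elim (¬p (g q))
  𝟙-⇔ (no _) (no _) _ _ = refl

  𝟙-comm : ∀ {p q} {P : Set p} {Q : Set q} (P? : Dec P) (Q? : Dec Q) x → 𝟙[ P? ] 𝟙[ Q? ] x ≈ 𝟙[ Q? ] 𝟙[ P? ] x
  𝟙-comm (yes _) _ x = refl
  𝟙-comm (no _) (yes _) x = refl
  𝟙-comm (no _) (no _) x = refl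

  𝟙-×-dec : ∀ {p q} {P : Set p} {Q : Set q} (P? : Dec P) (Q? : Dec Q) x → 𝟙[ P? ] 𝟙[ Q? ] x ≈ 𝟙[ P? ×-dec Q? ] x
  𝟙-×-dec (yes _) (yes _) x = refl
  𝟙-×-dec (yes _) (no _) x = refl
  𝟙-×-dec (no _) _ x = refl

  sumList : (ℕ → Carrier) → List ℕ → Carrier
  sumList f = foldr (λ k acc → f k + acc) 0#

  sumList-filter : ∀ {p} {P : ℕ → Set p} (P? : Decidable P) f xs →
                   sumList f (filter P? xs) ≈ sumList (λ x → 𝟙[ P? x ] f x) xs
  sumList-filter P? f [] = refl
  sumList-filter P? f (x ∷ xs) with P? x
  ... | yes _ = +-congˡ (sumList-filter P? f xs)
  ... | no _ = trans (sumList-filter P? f xs) (sym (+-identityˡ _))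

  sumList-map : ∀ f g xs → sumList f (map g xs) ≡ sumList (f ∘ g) xs
  sumList-map f g [] = ≡.refl
  sumList-map f g (x ∷ xs) = ≡.cong (λ s → f (g x) + s) (sumList-map f g xs)

  sumList-applyUpTo : ∀ f g n → sumList f (applyUpTo g n) ≈ ∑[ i < n ] f (g i)
  sumList-applyUpTo f g zero = refl
  sumList-applyUpTo f g (suc n) = begin
    f (g 0) + sumList f (applyUpTo (g ∘ suc) n) ≈⟨ +-congˡ (sumList-applyUpTo f (g ∘ suc) n) ⟩
    f (g 0) + ∑[ i < n ] f (g (suc i))          ≈⟨ sym (∑<-cons n (f ∘ g)) ⟩
    ∑< (suc n) (f ∘ g)                           ∎

  sumList-range1 : ∀ f n → sumList f (range1 n) ≈ ∑≤ n f
  sumList-range1 f n = trans (reflexive (sumList-map f suc (upTo n))) (trans (sumList-applyUpTo (f ∘ suc) (λ i → i) n) (sym (∑≤-as-∑< n f)))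

  ∑≤-multiples : ∀ {e} .{{_ : ℕ.NonZero e}} q (h : ℕ → Carrier) →
                 ∑[1≤ k ≤ q ℕ.* e ] 𝟙[ e ∣? k ] h k ≈ ∑[1≤ j ≤ q ] h (e ℕ.* j)
  ∑≤-multiples zero h = refl
  ∑≤-multiples {e} (suc q) h = begin
    ∑≤ (e ℕ.+ q ℕ.* e) G                        ≡⟨ ≡.cong (λ m → ∑≤ m G) (ℕP.+-comm e (q ℕ.* e)) ⟩
    ∑≤ (q ℕ.* e ℕ.+ e) G                        ≈⟨ ∑≤-split (q ℕ.* e) e G ⟩
    ∑≤ (q ℕ.* e) G + ∑[1≤ i ≤ e ] G (q ℕ.* e ℕ.+ i) ≈⟨ +-cong (∑≤-multiples q h) lastBlock ⟩
    ∑[1≤ j ≤ q ] h (e ℕ.* j) + h (e ℕ.* suc q)  ∎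
    where
    G : ℕ → Carrier
    G k = 𝟙[ e ∣? k ] h k
    notMultiple : ∀ i → 1 ≤ i → i ≤ e → i ≢ e → ¬ (e ∣ q ℕ.* e ℕ.+ i)
    notMultiple i 1≤i i≤e i≢e e∣ = i≢e (ℕP.≤-antisym i≤e (∣⇒≤ {{ℕ.>-nonZero 1≤i}} (∣m+n∣m⇒∣n e∣ (n∣m*n q))))
    lastBlock : ∑[1≤ i ≤ e ] G (q ℕ.* e ℕ.+ i) ≈ h (e ℕ.* suc q)
    lastBlock = begin
      ∑[1≤ i ≤ e ] G (q ℕ.* e ℕ.+ i)
        ≈⟨ ∑≤-single e e (ℕ.>-nonZero⁻¹ e) ℕP.≤-refl (λ i 1≤i i≤e i≢e → 𝟙-no (e ∣? _) (notMultiple i 1≤i i≤e i≢e)) ⟩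
      G (q ℕ.* e ℕ.+ e) ≈⟨ 𝟙-yes (e ∣? _) (∣m∣n⇒∣m+n (n∣m*n q) ∣-refl) ⟩
      h (q ℕ.* e ℕ.+ e) ≡⟨ ≡.cong h (≡.trans (ℕP.+-comm (q ℕ.* e) e) (ℕP.*-comm (suc q) e)) ⟩
      h (e ℕ.* suc q)   ∎

  ∑≤-divisorPair : ∀ {n} .{{_ : ℕ.NonZero n}} d .{{_ : ℕ.NonZero d}} (h : ℕ → Carrier) →
                   ∑[1≤ e ≤ n ] 𝟙[ d ℕ.* e ℕ.≟ n ] h e ≈ 𝟙[ d ∣? n ] h (quot n d)
  ∑≤-divisorPair {n} d@(suc _) h with d ∣? n
  ... | no d∤n = ∑≤-zero n (λ e _ _ → 𝟙-no (d ℕ.* e ℕ.≟ n) (λ de≡n → d∤n (divides e (≡.trans (≡.sym de≡n) (ℕP.*-comm d e)))))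
  ... | yes (divides q ≡.refl) = begin
    ∑[1≤ e ≤ q ℕ.* d ] 𝟙[ d ℕ.* e ℕ.≟ q ℕ.* d ] h e
      ≈⟨ ∑≤-single (q ℕ.* d) q 1≤q (ℕP.m≤m*n q d) (λ k _ _ k≢q → 𝟙-no (d ℕ.* k ℕ.≟ q ℕ.* d)
           (λ dk≡qd → k≢q (ℕP.*-cancelˡ-≡ k q d (≡.trans dk≡qd (ℕP.*-comm q d))))) ⟩
    𝟙[ d ℕ.* q ℕ.≟ q ℕ.* d ] h q ≈⟨ 𝟙-yes (d ℕ.* q ℕ.≟ q ℕ.* d) (ℕP.*-comm d q) ⟩
    h q                          ≡⟨ ≡.cong h (≡.sym (DM.m*n/n≡m q d)) ⟩
    h (quot (q ℕ.* d) d)         ∎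
    where
    1≤q : 1 ≤ q
    1≤q = ℕ.>-nonZero⁻¹ q {{ℕP.m*n≢0⇒m≢0 q}}

  ∑≤-divisors-reverse : ∀ n .{{_ : ℕ.NonZero n}} (f : ℕ → Carrier) →
                        ∑[1≤ d ≤ n ] 𝟙[ d ∣? n ] f d ≈ ∑[1≤ e ≤ n ] 𝟙[ e ∣? n ] f (quot n e)
  ∑≤-divisors-reverse n f = begin
    ∑[1≤ d ≤ n ] 𝟙[ d ∣? n ] f d
      ≈⟨ ∑≤-cong n (λ d 1≤d _ → sym (∑≤-divisorPair d {{ℕ.>-nonZero 1≤d}} (λ _ → f d))) ⟩
    ∑[1≤ d ≤ n ] ∑[1≤ e ≤ n ] 𝟙[ d ℕ.* e ℕ.≟ n ] f d
      ≈⟨ ∑≤-comm n n _ ⟩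
    ∑[1≤ e ≤ n ] ∑[1≤ d ≤ n ] 𝟙[ d ℕ.* e ℕ.≟ n ] f d
      ≈⟨ ∑≤-cong n (λ e _ _ → ∑≤-cong n (λ d _ _ →
           𝟙-⇔ (d ℕ.* e ℕ.≟ n) (e ℕ.* d ℕ.≟ n) (≡.trans (ℕP.*-comm e d)) (≡.trans (ℕP.*-comm d e)))) ⟩
    ∑[1≤ e ≤ n ] ∑[1≤ d ≤ n ] 𝟙[ e ℕ.* d ℕ.≟ n ] f d
      ≈⟨ ∑≤-cong n (λ e 1≤e _ → ∑≤-divisorPair e {{ℕ.>-nonZero 1≤e}} f) ⟩
    ∑[1≤ e ≤ n ] 𝟙[ e ∣? n ] f (quot n e) ∎

module RingSum {c ℓ} (R : CommutativeRing c ℓ) where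
  open CommutativeRing R
  open RangeSum +-commutativeMonoid public
  open import Algebra.Properties.Ring ring using (-0#≈0#; -‿+-comm)

  ∑≤-distribˡ : ∀ n a (f : ℕ → Carrier) → a * ∑≤ n f ≈ ∑[1≤ k ≤ n ] (a * f k)
  ∑≤-distribˡ zero a f = zeroʳ a
  ∑≤-distribˡ (suc n) a f = trans (distribˡ a _ _) (+-congʳ (∑≤-distribˡ n a f))

  ∑≤-distribʳ : ∀ n a (f : ℕ → Carrier) → ∑≤ n f * a ≈ ∑[1≤ k ≤ n ] (f k * a)
  ∑≤-distribʳ zero a f = zeroˡ a
  ∑≤-distribʳ (suc n) a f = trans (distribʳ a _ _) (+-congʳ (∑≤-distribʳ n a f))

  ∑<-neg : ∀ n (f : ℕ → Carrier) → ∑[ i < n ] (- f i) ≈ - ∑< n f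
  ∑<-neg zero f = sym -0#≈0#
  ∑<-neg (suc n) f = trans (+-congʳ (∑<-neg n f)) (-‿+-comm _ _)

  ∑≤-neg : ∀ n (f : ℕ → Carrier) → ∑[1≤ k ≤ n ] (- f k) ≈ - ∑≤ n f
  ∑≤-neg zero f = sym -0#≈0#
  ∑≤-neg (suc n) f = trans (+-congʳ (∑≤-neg n f)) (-‿+-comm _ _)

  𝟙-neg : ∀ {p} {P : Set p} (P? : Dec P) x → 𝟙[ P? ] (- x) ≈ - 𝟙[ P? ] x
  𝟙-neg (yes _) x = refl
  𝟙-neg (no _) x = sym -0#≈0#

  𝟙-distribˡ : ∀ {p} {P : Set p} (P? : Dec P) a x → a * 𝟙[ P? ] x ≈ 𝟙[ P? ] (a * x)
  𝟙-distribˡ (yes _) a x = refl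
  𝟙-distribˡ (no _) a x = zeroʳ a

∈-range1 : ∀ {k n} → 1 ≤ k → k ≤ n → k ∈ range1 n
∈-range1 {suc k} _ k<n = ∈-map⁺ suc (∈-upTo⁺ k<n)

SquareFree : ℕ → Set
SquareFree n = ∀ k → 2 ≤ k → ¬ (k ℕ.* k ∣ n)

square∈hasSquareFactor : ∀ {n} .{{_ : ℕ.NonZero n}} {k} → 2 ≤ k → k ℕ.* k ∣ n → k ∈ hasSquareFactor n
square∈hasSquareFactor {n} {k} 2≤k kk∣n =
  ∈-filter⁺ (λ k → (2 ℕ.≤? k) ×-dec ((k ℕ.* k) ∣? n))
            (∈-range1 (ℕP.≤-trans (s≤s z≤n) 2≤k) (∣⇒≤ (∣-trans (m∣m*n k) kk∣n))) (2≤k , kk∣n)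

squareFree⊎square : ∀ n → SquareFree n ⊎ ∃[ k ] (2 ≤ k P× k ℕ.* k ∣ n)
squareFree⊎square zero = inj₂ (2 , ℕP.≤-refl , 4 ∣0)
squareFree⊎square n@(suc _) with hasSquareFactor n in eq
... | [] = inj₁ (λ k 2≤k kk∣n → case (≡.subst (k ∈_) eq (square∈hasSquareFactor 2≤k kk∣n)))
  where case : ∀ {k} → ¬ (k ∈ [])
        case ()
... | k ∷ _ = inj₂ (k , proj₂ (∈-filter⁻ (λ k → (2 ℕ.≤? k) ×-dec ((k ℕ.* k) ∣? n)) {xs = range1 n}
                                  (≡.subst (k ∈_) (≡.sym eq) (here ≡.refl))))

μ-squareFree : ∀ n → SquareFree n → μ n ≡ negOnePow (length (primeDivisors n))
μ-squareFree zero sf = contradiction (4 ∣0) (sf 2 ℕP.≤-refl)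
μ-squareFree n@(suc _) sf
  rewrite filter-none (λ k → (2 ℕ.≤? k) ×-dec ((k ℕ.* k) ∣? n)) (All.universal (λ k (2≤k , kk∣n) → sf k 2≤k kk∣n) (range1 n))
  = ≡.refl

μ-square : ∀ n {k} → 2 ≤ k → k ℕ.* k ∣ n → μ n ≡ + 0
μ-square zero _ _ = ≡.refl
μ-square n@(suc _) 2≤k kk∣n with hasSquareFactor n | square∈hasSquareFactor {n} 2≤k kk∣n
... | _ ∷ _ | _ = ≡.refl

prime≥2 : ∀ {p} → Prime p → 2 ≤ p
prime≥2 {p} pr = ℕ.nonTrivial⇒n>1 p {{prime⇒nonTrivial pr}}

squareFree-*-prime : ∀ {p d} → Prime p → ¬ p ∣ d → SquareFree d → SquareFree (p ℕ.* d)
squareFree-*-prime {p} {d} pr p∤d sf k 2≤k kk∣pd with p ∣? k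
... | yes p∣k = p∤d (*-cancelˡ-∣ p {{prime⇒nonZero pr}} (∣-trans (*-pres-∣ p∣k p∣k) kk∣pd))
... | no p∤k = sf k 2≤k (coprime-divisor coprime kk∣pd)
  where
  coprime : Coprime (k ℕ.* k) p
  coprime {i} (i∣kk , i∣p) with prime⇒irreducible pr i∣p
  ... | inj₁ i≡1 = i≡1
  ... | inj₂ ≡.refl = ⊥-elim ([ p∤k , p∤k ]′ (euclidsLemma k k pr i∣kk))

module PrimeCount where
  open RangeSum ℕP.+-0-commutativeMonoid

  length-filter : ∀ {p} {P : ℕ → Set p} (P? : Decidable P) xs → length (filter P? xs) ≡ sumList (λ x → 𝟙[ P? x ] 1) xs
  length-filter P? [] = ≡.refl
  length-filter P? (x ∷ xs) with P? x
  ... | yes _ = ≡.cong suc (length-filter P? xs)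
  ... | no _ = length-filter P? xs

  length-primeDivisors : ∀ n → length (primeDivisors n) ≡ ∑[1≤ q ≤ n ] 𝟙[ prime? q ×-dec q ∣? n ] 1
  length-primeDivisors n = ≡.trans (length-filter (λ q → prime? q ×-dec q ∣? n) (range1 n)) (sumList-range1 _ n)

  primeDivisor-*-prime : ∀ {p d} q → Prime p → ¬ p ∣ d →
    𝟙[ prime? q ×-dec q ∣? p ℕ.* d ] 1 ≡ 𝟙[ q ℕ.≟ p ] 1 ℕ.+ 𝟙[ prime? q ×-dec q ∣? d ] 1
  primeDivisor-*-prime {p} {d} q pr p∤d with prime? q ×-dec q ∣? p ℕ.* d | q ℕ.≟ p | prime? q ×-dec q ∣? d
  ... | yes _ | yes ≡.refl | yes (_ , q∣d) = contradiction q∣d p∤d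
  ... | yes _ | yes _ | no _ = ≡.refl
  ... | yes _ | no _ | yes _ = ≡.refl
  ... | yes (prq , q∣pd) | no q≢p | no ¬q∣d with euclidsLemma p d prq q∣pd
  ...   | inj₂ q∣d = contradiction (prq , q∣d) ¬q∣d
  ...   | inj₁ q∣p with prime⇒irreducible pr q∣p
  ...     | inj₁ ≡.refl = contradiction (prime≥2 prq) λ { (s≤s ()) }
  ...     | inj₂ q≡p = contradiction q≡p q≢p
  primeDivisor-*-prime q pr p∤d | no ¬q∣pd | yes ≡.refl | _ = contradiction (pr , m∣m*n _) ¬q∣pd
  primeDivisor-*-prime {p} q pr p∤d | no ¬q∣pd | no _ | yes (prq , q∣d) = contradiction (prq , ∣n⇒∣m*n p q∣d) ¬q∣pd
  primeDivisor-*-prime q pr p∤d | no _ | no _ | no _ = ≡.refl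

  length-primeDivisors-*-prime : ∀ {p d} .{{_ : ℕ.NonZero d}} → Prime p → ¬ p ∣ d →
                                 length (primeDivisors (p ℕ.* d)) ≡ suc (length (primeDivisors d))
  length-primeDivisors-*-prime {p} {d} pr p∤d = begin
    length (primeDivisors (p ℕ.* d))
      ≡⟨ length-primeDivisors (p ℕ.* d) ⟩
    ∑[1≤ q ≤ p ℕ.* d ] 𝟙[ prime? q ×-dec q ∣? p ℕ.* d ] 1
      ≡⟨ ∑≤-cong (p ℕ.* d) (λ q _ _ → primeDivisor-*-prime q pr p∤d) ⟩
    ∑[1≤ q ≤ p ℕ.* d ] (𝟙[ q ℕ.≟ p ] 1 ℕ.+ 𝟙[ prime? q ×-dec q ∣? d ] 1)
      ≡⟨ ∑≤-distrib-+ (p ℕ.* d) _ _ ⟩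
    ∑[1≤ q ≤ p ℕ.* d ] 𝟙[ q ℕ.≟ p ] 1 ℕ.+ ∑[1≤ q ≤ p ℕ.* d ] 𝟙[ prime? q ×-dec q ∣? d ] 1
      ≡⟨ ≡.cong₂ ℕ._+_ (∑≤-single (p ℕ.* d) p 1≤p p≤pd (λ k _ _ → 𝟙-no (k ℕ.≟ p)))
                       (∑≤-extend d≤pd (λ k d<k _ → 𝟙-no (prime? k ×-dec k ∣? d) (λ (_ , k∣d) → ℕP.<⇒≱ d<k (∣⇒≤ k∣d)))) ⟩
    𝟙[ p ℕ.≟ p ] 1 ℕ.+ ∑[1≤ q ≤ d ] 𝟙[ prime? q ×-dec q ∣? d ] 1
      ≡⟨ ≡.cong₂ ℕ._+_ (𝟙-yes (p ℕ.≟ p) ≡.refl) (≡.sym (length-primeDivisors d)) ⟩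
    suc (length (primeDivisors d)) ∎
    where
    open ≡.≡-Reasoning
    instance _ = prime⇒nonZero pr
    1≤p : 1 ≤ p
    1≤p = ℕ.>-nonZero⁻¹ p
    p≤pd : p ≤ p ℕ.* d
    p≤pd = ℕP.m≤m*n p d
    d≤pd : d ≤ p ℕ.* d
    d≤pd = ℕP.m≤n*m d p

open PrimeCount using (length-primeDivisors-*-prime)

quot-involutive : ∀ {n e} .{{_ : ℕ.NonZero n}} → e ∣ n → quot n (quot n e) ≡ e
quot-involutive {n} {zero} 0∣n = contradiction (0∣⇒≡0 0∣n) (ℕ.≢-nonZero⁻¹ n)
quot-involutive {n} {e@(suc _)} (divides zero n≡0) = contradiction n≡0 (ℕ.≢-nonZero⁻¹ n)
quot-involutive {e = e@(suc _)} (divides q@(suc _) ≡.refl) = begin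
  quot (q ℕ.* e) (quot (q ℕ.* e) e) ≡⟨ ≡.cong (quot (q ℕ.* e)) (DM.m*n/n≡m q e) ⟩
  quot (q ℕ.* e) q                  ≡⟨ ≡.cong (λ m → quot m q) (ℕP.*-comm q e) ⟩
  quot (e ℕ.* q) q                  ≡⟨ DM.m*n/n≡m e q ⟩
  e                                 ∎
  where open ≡.≡-Reasoning

coprime⇒<n : ∀ {n k} → 2 ≤ n → k ≤ n → gcd n k ≡ 1 → k < n
coprime⇒<n {n} 2≤n k≤n gcd≡1 = ℕP.≤∧≢⇒< k≤n λ { ≡.refl →
  ℕP.>⇒≢ 2≤n (∣1⇒≡1 (≡.subst (n ∣_) gcd≡1 (gcd-greatest ∣-refl ∣-refl))) }

primeFactor : ∀ n → 2 ≤ n → ∃[ p ] (Prime p P× p ∣ n)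
primeFactor n@(suc _) 2≤n with factorise n
... | record { factors = [] ; isFactorisation = n≡1 } = contradiction n≡1 (ℕP.>⇒≢ 2≤n)
... | record { factors = p ∷ _ ; isFactorisation = n≡p*ps ; factorsPrime = pr ∷ _ } =
  p , pr , ≡.subst (p ∣_) (≡.sym n≡p*ps) (m∣m*n _)

module Möbius where
  open RingSum ℤP.+-*-commutativeRing

  μ-*-prime : ∀ {p d} .{{_ : ℕ.NonZero d}} → Prime p → μ (p ℕ.* d) ≡ 𝟙[ ¬? (p ∣? d) ] (ℤ.- μ d)
  μ-*-prime {p} {d} pr with p ∣? d
  ... | yes p∣d = μ-square (p ℕ.* d) (prime≥2 pr) (*-monoʳ-∣ p p∣d)
  ... | no p∤d with squareFree⊎square d
  ...   | inj₁ sf = ≡.trans (μ-squareFree (p ℕ.* d) (squareFree-*-prime pr p∤d sf))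
                     (≡.trans (≡.cong negOnePow (length-primeDivisors-*-prime pr p∤d)) (≡.cong ℤ.-_ (≡.sym (μ-squareFree d sf))))
  ...   | inj₂ (k , 2≤k , kk∣d) = ≡.trans (μ-square (p ℕ.* d) 2≤k (∣n⇒∣m*n p kk∣d)) (≡.cong ℤ.-_ (≡.sym (μ-square d 2≤k kk∣d)))

  ∑-μ-multipleOfPrime : ∀ {p} M .{{_ : ℕ.NonZero M}} → Prime p → ∑[1≤ d ≤ M ℕ.* p ] 𝟙[ d ∣? M ℕ.* p ] μ d ≡ + 0
  -- For p ∤ d, the divisors d and p·d of M·p cancel, since μ(p·d) = −μ(d).
  ∑-μ-multipleOfPrime {p} M pr = begin
    ∑≤ N t                                                        ≡⟨ ∑≤-cong N (λ d _ _ → 𝟙-split (p ∣? d) (t d)) ⟩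
    ∑[1≤ d ≤ N ] (𝟙[ p ∣? d ] t d ℤ.+ 𝟙[ ¬? (p ∣? d) ] t d)      ≡⟨ ∑≤-distrib-+ N _ _ ⟩
    ∑[1≤ d ≤ N ] 𝟙[ p ∣? d ] t d ℤ.+ ∑[1≤ d ≤ N ] 𝟙[ ¬? (p ∣? d) ] t d ≡⟨ ≡.cong₂ ℤ._+_ multiplesOfP otherDivisors ⟩
    ℤ.- ∑≤ M s ℤ.+ ∑≤ M s                                           ≡⟨ ℤP.+-inverseˡ (∑≤ M s) ⟩
    + 0                                                           ∎
    where
    open ≡.≡-Reasoning
    instance _ = prime⇒nonZero pr
    N : ℕ
    N = M ℕ.* p
    t s : ℕ → ℤ
    t d = 𝟙[ d ∣? N ] μ d
    s d = 𝟙[ d ∣? M ] 𝟙[ ¬? (p ∣? d) ] μ d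
    multiplesOfP : ∑[1≤ d ≤ N ] 𝟙[ p ∣? d ] t d ≡ ℤ.- ∑≤ M s
    multiplesOfP = begin
      ∑[1≤ d ≤ N ] 𝟙[ p ∣? d ] t d     ≡⟨ ∑≤-multiples M t ⟩
      ∑[1≤ d ≤ M ] t (p ℕ.* d)         ≡⟨ ∑≤-cong M (λ d 1≤d _ → term d {{ℕ.>-nonZero 1≤d}}) ⟩
      ∑[1≤ d ≤ M ] (ℤ.- s d)            ≡⟨ ∑≤-neg M s ⟩
      ℤ.- ∑≤ M s                       ∎
      where
      term : ∀ d .{{_ : ℕ.NonZero d}} → t (p ℕ.* d) ≡ ℤ.- s d
      term d = begin
        𝟙[ p ℕ.* d ∣? N ] μ (p ℕ.* d)        ≡⟨ 𝟙-⇔ (p ℕ.* d ∣? N) (d ∣? M)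
                                                   (λ pd∣Mp → *-cancelˡ-∣ p (≡.subst (p ℕ.* d ∣_) (ℕP.*-comm M p) pd∣Mp))
                                                   (λ d∣M → ≡.subst (p ℕ.* d ∣_) (ℕP.*-comm p M) (*-monoʳ-∣ p d∣M)) ⟩
        𝟙[ d ∣? M ] μ (p ℕ.* d)              ≡⟨ ≡.cong 𝟙[ d ∣? M ]_ (≡.trans (μ-*-prime pr) (𝟙-neg (¬? (p ∣? d)) (μ d))) ⟩
        𝟙[ d ∣? M ] (ℤ.- 𝟙[ ¬? (p ∣? d) ] μ d) ≡⟨ 𝟙-neg (d ∣? M) _ ⟩
        ℤ.- s d                              ∎
    otherDivisors : ∑[1≤ d ≤ N ] 𝟙[ ¬? (p ∣? d) ] t d ≡ ∑≤ M s
    otherDivisors = begin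
      ∑[1≤ d ≤ N ] 𝟙[ ¬? (p ∣? d) ] t d ≡⟨ ∑≤-cong N (λ d _ _ → ≡.trans (𝟙-cong (¬? (p ∣? d)) (λ p∤d →
                                           𝟙-⇔ (d ∣? N) (d ∣? M) (coprime-divisor (coprime p∤d) ∘ ≡.subst (d ∣_) (ℕP.*-comm M p)) (∣m⇒∣m*n p)))
                                           (𝟙-comm (¬? (p ∣? d)) (d ∣? M) (μ d))) ⟩
      ∑≤ N s                             ≡⟨ ∑≤-extend (ℕP.m≤m*n M p) (λ d M<d _ → 𝟙-no (d ∣? M) (λ d∣M → ℕP.<⇒≱ M<d (∣⇒≤ d∣M))) ⟩
      ∑≤ M s                             ∎
      where
      coprime : ∀ {d} → ¬ p ∣ d → Coprime d p
      coprime {d} p∤d {i} (i∣d , i∣p) with prime⇒irreducible pr i∣p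
      ... | inj₁ i≡1 = i≡1
      ... | inj₂ ≡.refl = contradiction i∣d p∤d

  ∑-μ-divisors : ∀ n .{{_ : ℕ.NonZero n}} → ∑[1≤ d ≤ n ] 𝟙[ d ∣? n ] μ d ≡ 𝟙[ n ℕ.≟ 1 ] (+ 1)
  ∑-μ-divisors 1 = ≡.refl
  ∑-μ-divisors n@(suc (suc _)) with primeFactor n (s≤s (s≤s z≤n))
  ... | p , pr , divides M n≡M*p = ≡.trans (≡.subst (λ m → ∑[1≤ d ≤ m ] 𝟙[ d ∣? m ] μ d ≡ + 0) (≡.sym n≡M*p)
                                              (∑-μ-multipleOfPrime M {{ℕP.m*n≢0⇒m≢0 M {{≡.subst ℕ.NonZero n≡M*p ℕ.nonZero}}}} pr))
                                           (≡.sym (𝟙-no (n ℕ.≟ 1) {+ 1} λ ()))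

  𝟙-coprime : ∀ n .{{_ : ℕ.NonZero n}} k → 𝟙[ gcd n k ℕ.≟ 1 ] (+ 1) ≡ ∑[1≤ e ≤ n ] 𝟙[ e ∣? n ] 𝟙[ e ∣? k ] μ e
  𝟙-coprime n k = begin
    𝟙[ g ℕ.≟ 1 ] (+ 1)                              ≡⟨ ≡.sym (∑-μ-divisors g) ⟩
    ∑[1≤ e ≤ g ] 𝟙[ e ∣? g ] μ e                      ≡⟨ ∑≤-cong g (λ e _ _ → ≡.sym (commonDivisor e)) ⟩
    ∑[1≤ e ≤ g ] 𝟙[ e ∣? n ] 𝟙[ e ∣? k ] μ e          ≡⟨ ≡.sym (∑≤-extend (∣⇒≤ (gcd[m,n]∣m n k)) (λ e g<e _ →
                                                          ≡.trans (commonDivisor e) (𝟙-no (e ∣? g) (λ e∣g → ℕP.<⇒≱ g<e (∣⇒≤ e∣g))))) ⟩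
    ∑[1≤ e ≤ n ] 𝟙[ e ∣? n ] 𝟙[ e ∣? k ] μ e          ∎
    where
    open ≡.≡-Reasoning
    g : ℕ
    g = gcd n k
    instance _ = ℕ.≢-nonZero (gcd[m,n]≢0 n k (inj₁ (ℕ.≢-nonZero⁻¹ n)))
    commonDivisor : ∀ e → 𝟙[ e ∣? n ] 𝟙[ e ∣? k ] μ e ≡ 𝟙[ e ∣? g ] μ e
    commonDivisor e = ≡.trans (𝟙-×-dec (e ∣? n) (e ∣? k) (μ e))
      (𝟙-⇔ ((e ∣? n) ×-dec (e ∣? k)) (e ∣? g) (λ (e∣n , e∣k) → gcd-greatest e∣n e∣k)
           (λ e∣g → ∣-trans e∣g (gcd[m,n]∣m n k) , ∣-trans e∣g (gcd[m,n]∣n n k)))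

  J₂-as-∑ : ∀ n .{{_ : ℕ.NonZero n}} → J₂ n ≡ ∑[1≤ e ≤ n ] 𝟙[ e ∣? n ] (μ e ℤ.* + (quot n e ℕ.* quot n e))
  J₂-as-∑ n = begin
    J₂ n                                           ≡⟨ foldr-map ℤ._+_ h (+ 0) (divisors n) ⟩
    sumList h (divisors n)                         ≡⟨ sumList-filter (_∣? n) h (range1 n) ⟩
    sumList (λ d → 𝟙[ d ∣? n ] h d) (range1 n)     ≡⟨ sumList-range1 _ n ⟩
    ∑[1≤ d ≤ n ] 𝟙[ d ∣? n ] h d                   ≡⟨ ∑≤-divisors-reverse n h ⟩
    ∑[1≤ e ≤ n ] 𝟙[ e ∣? n ] h (quot n e)          ≡⟨ ∑≤-cong n (λ e _ _ → 𝟙-cong (e ∣? n) (λ e∣n →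
                                                       ≡.cong (λ d → μ d ℤ.* + (quot n e ℕ.* quot n e)) (quot-involutive e∣n))) ⟩
    ∑[1≤ e ≤ n ] 𝟙[ e ∣? n ] (μ e ℤ.* + (quot n e ℕ.* quot n e)) ∎
    where
    open ≡.≡-Reasoning
    h : ℕ → ℤ
    h d = μ (quot n d) ℤ.* + (d ℕ.* d)

  J₂-as-∑-μ[q²-1] : ∀ n → 2 ≤ n → J₂ n ≡ ∑[1≤ e ≤ n ] 𝟙[ e ∣? n ] (μ e ℤ.* (+ (quot n e ℕ.* quot n e) ℤ.- + 1))
  J₂-as-∑-μ[q²-1] 1 (s≤s ())
  J₂-as-∑-μ[q²-1] n@(suc (suc _)) _ = begin
    J₂ n                                                  ≡⟨ J₂-as-∑ n ⟩
    ∑≤ n f                                                ≡⟨ ≡.sym (ℤP.+-identityʳ _) ⟩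
    ∑≤ n f ℤ.+ ℤ.- 𝟙[ n ℕ.≟ 1 ] (+ 1)                      ≡⟨ ≡.cong (λ z → ∑≤ n f ℤ.+ ℤ.- z) (≡.sym (∑-μ-divisors n)) ⟩
    ∑≤ n f ℤ.+ ℤ.- ∑[1≤ e ≤ n ] 𝟙[ e ∣? n ] μ e           ≡⟨ ≡.cong (λ z → ∑≤ n f ℤ.+ z) (≡.sym (∑≤-neg n _)) ⟩
    ∑≤ n f ℤ.+ ∑[1≤ e ≤ n ] (ℤ.- 𝟙[ e ∣? n ] μ e)         ≡⟨ ≡.sym (∑≤-distrib-+ n _ _) ⟩
    ∑[1≤ e ≤ n ] (f e ℤ.+ ℤ.- 𝟙[ e ∣? n ] μ e)            ≡⟨ ∑≤-cong n (λ e _ _ → 𝟙-μ[q²-1] (e ∣? n) (μ e) _) ⟩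
    ∑[1≤ e ≤ n ] 𝟙[ e ∣? n ] (μ e ℤ.* (+ (quot n e ℕ.* quot n e) ℤ.- + 1)) ∎
    where
    open ≡.≡-Reasoning
    f : ℕ → ℤ
    f e = 𝟙[ e ∣? n ] (μ e ℤ.* + (quot n e ℕ.* quot n e))
    𝟙-μ[q²-1] : ∀ {p} {P : Set p} (P? : Dec P) a b → 𝟙[ P? ] (a ℤ.* b) ℤ.+ ℤ.- 𝟙[ P? ] a ≡ 𝟙[ P? ] (a ℤ.* (b ℤ.- + 1))
    𝟙-μ[q²-1] (yes _) a b = ab-a≡a[b-1] a b
      where
      ab-a≡a[b-1] : ∀ a b → a ℤ.* b ℤ.+ ℤ.- a ≡ a ℤ.* (b ℤ.- + 1)
      ab-a≡a[b-1] = solve-∀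
    𝟙-μ[q²-1] (no _) a b = ≡.refl

open Möbius using (𝟙-coprime; J₂-as-∑-μ[q²-1])

module ℤΣ = RingSum ℤP.+-*-commutativeRing

module FieldArithmetic {c ℓ} (F : Field c ℓ) where
  open Field F
  open RingSum commutativeRing public
  open SetoidReasoning setoid
  open import Algebra.Properties.Ring ring using (-‿involutive; -0#≈0#; -‿distribˡ-*; -‿distribʳ-*; -‿+-comm)
  open import Algebra.Properties.Monoid.Mult +-monoid using (×-homo-+)
  open CommSemigroupProperties +-commutativeSemigroup using (interchange; x∙yz≈y∙xz)
  open import Algebra.Properties.Semiring.Mult semiring using (×1-homo-*)
  open import Algebra.Properties.Semiring.Exp semiring using (^-assocʳ; ^-congʳ)

  fromℕ : ℕ → Carrier
  fromℕ n = n × 1#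

  fromℕ-+ : ∀ m n → fromℕ (m ℕ.+ n) ≈ fromℕ m + fromℕ n
  fromℕ-+ = ×-homo-+ 1#

  fromℕ-* : ∀ m n → fromℕ (m ℕ.* n) ≈ fromℕ m * fromℕ n
  fromℕ-* = ×1-homo-*

  fromℤ-⊖ : ∀ m n → fromℤ (m ⊖ n) ≈ fromℕ m - fromℕ n
  fromℤ-⊖ zero zero = sym (-‿inverseʳ 0#)
  fromℤ-⊖ zero (suc n) = sym (+-identityˡ _)
  fromℤ-⊖ (suc m) zero = sym (trans (+-congˡ -0#≈0#) (+-identityʳ _))
  fromℤ-⊖ (suc m) (suc n) = begin
    fromℤ (suc m ⊖ suc n)               ≡⟨ ≡.cong fromℤ (ℤP.[1+m]⊖[1+n]≡m⊖n m n) ⟩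
    fromℤ (m ⊖ n)                       ≈⟨ fromℤ-⊖ m n ⟩
    fromℕ m - fromℕ n                   ≈⟨ sym (+-identityˡ _) ⟩
    0# + (fromℕ m - fromℕ n)            ≈⟨ +-congʳ (sym (-‿inverseʳ 1#)) ⟩
    (1# - 1#) + (fromℕ m - fromℕ n)     ≈⟨ interchange _ _ _ _ ⟩
    (1# + fromℕ m) + (- 1# - fromℕ n)   ≈⟨ +-congˡ (-‿+-comm 1# (fromℕ n)) ⟩
    (1# + fromℕ m) - (1# + fromℕ n)     ∎

  fromℤ-neg : ∀ i → fromℤ (ℤ.- i) ≈ - fromℤ i
  fromℤ-neg (+ zero) = sym -0#≈0#
  fromℤ-neg (+ suc n) = refl
  fromℤ-neg -[1+ n ] = sym (-‿involutive _)

  fromℤ-+ : ∀ i j → fromℤ (i ℤ.+ j) ≈ fromℤ i + fromℤ j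
  fromℤ-+ -[1+ m ] -[1+ n ] = begin
    - fromℕ (suc (suc (m ℕ.+ n)))          ≈⟨ -‿cong (+-congˡ (fromℕ-+ (suc m) n)) ⟩
    - (1# + ((1# + fromℕ m) + fromℕ n))    ≈⟨ -‿cong (x∙yz≈y∙xz 1# (1# + fromℕ m) (fromℕ n)) ⟩
    - ((1# + fromℕ m) + (1# + fromℕ n))    ≈⟨ sym (-‿+-comm _ _) ⟩
    - (1# + fromℕ m) - (1# + fromℕ n)      ∎
  fromℤ-+ -[1+ m ] (+ n) = trans (fromℤ-⊖ n (suc m)) (+-comm _ _)
  fromℤ-+ (+ m) -[1+ n ] = fromℤ-⊖ m (suc n)
  fromℤ-+ (+ m) (+ n) = fromℕ-+ m n

  fromℤ-*-+ : ∀ m j → fromℤ (+ m ℤ.* j) ≈ fromℕ m * fromℤ j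
  fromℤ-*-+ m (+ n) = trans (reflexive (≡.cong fromℤ (≡.sym (ℤP.pos-* m n)))) (fromℕ-* m n)
  fromℤ-*-+ m -[1+ n ] = begin
    fromℤ (+ m ℤ.* -[1+ n ])          ≡⟨ ≡.cong fromℤ (ℤP.neg-distribʳ-* (+ m) (+ suc n)) ⟨
    fromℤ (ℤ.- (+ m ℤ.* + suc n))     ≈⟨ fromℤ-neg (+ m ℤ.* + suc n) ⟩
    - fromℤ (+ m ℤ.* + suc n)         ≈⟨ -‿cong (fromℤ-*-+ m (+ suc n)) ⟩
    - (fromℕ m * fromℕ (suc n))       ≈⟨ -‿distribʳ-* _ _ ⟩
    fromℕ m * - fromℕ (suc n)         ∎

  fromℤ-* : ∀ i j → fromℤ (i ℤ.* j) ≈ fromℤ i * fromℤ j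
  fromℤ-* (+ m) j = fromℤ-*-+ m j
  fromℤ-* -[1+ m ] j = begin
    fromℤ (-[1+ m ] ℤ.* j)            ≡⟨ ≡.cong fromℤ (ℤP.neg-distribˡ-* (+ suc m) j) ⟨
    fromℤ (ℤ.- (+ suc m ℤ.* j))       ≈⟨ fromℤ-neg (+ suc m ℤ.* j) ⟩
    - fromℤ (+ suc m ℤ.* j)           ≈⟨ -‿cong (fromℤ-*-+ (suc m) j) ⟩
    - (fromℕ (suc m) * fromℤ j)       ≈⟨ -‿distribˡ-* _ _ ⟩
    - fromℕ (suc m) * fromℤ j         ∎

  -- Integer constants of the solver are interpreted so that 0, 1 and k ≥ 2 evaluate
  -- definitionally to 0#, 1# and k × 1#, the forms in which they occur in goals.
  constant : ℤ → Carrier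
  constant (+ 0) = 0#
  constant (+ 1) = 1#
  constant (+ suc (suc n)) = fromℕ (suc (suc n))
  constant -[1+ 0 ] = - 1#
  constant -[1+ suc n ] = - fromℕ (suc (suc n))

  constant≈fromℤ : ∀ i → constant i ≈ fromℤ i
  constant≈fromℤ (+ 0) = refl
  constant≈fromℤ (+ 1) = sym (+-identityʳ 1#)
  constant≈fromℤ (+ suc (suc n)) = refl
  constant≈fromℤ -[1+ 0 ] = -‿cong (sym (+-identityʳ 1#))
  constant≈fromℤ -[1+ suc n ] = refl

  private
    almostCommutativeRing : ACR.AlmostCommutativeRing c ℓ
    almostCommutativeRing = ACR.fromCommutativeRing commutativeRing

    constant-homo : ℤ.+-*-rawRing ACR.-Raw-AlmostCommutative⟶ almostCommutativeRing
    constant-homo = record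
      { ⟦_⟧ = constant
      ; +-homo = λ i j → trans (constant≈fromℤ (i ℤ.+ j)) (trans (fromℤ-+ i j) (sym (+-cong (constant≈fromℤ i) (constant≈fromℤ j))))
      ; *-homo = λ i j → trans (constant≈fromℤ (i ℤ.* j)) (trans (fromℤ-* i j) (sym (*-cong (constant≈fromℤ i) (constant≈fromℤ j))))
      ; -‿homo = λ i → trans (constant≈fromℤ (ℤ.- i)) (trans (fromℤ-neg i) (-‿cong (sym (constant≈fromℤ i))))
      ; 0-homo = refl
      ; 1-homo = refl
      }

    constant-≟ : ∀ i j → Maybe (constant i ≈ constant j)
    constant-≟ i j with i ℤ.≟ j
    ... | yes ≡.refl = just refl
    ... | no _ = nothing

  open Algebra.Solver.Ring ℤ.+-*-rawRing almostCommutativeRing constant-homo constant-≟ public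
    using (solve; _:+_; _:*_; _:-_; :-_; _:=_; con)

  fromℤ-∑≤ : ∀ n f → fromℤ (ℤΣ.∑≤ n f) ≈ ∑[1≤ k ≤ n ] fromℤ (f k)
  fromℤ-∑≤ zero f = refl
  fromℤ-∑≤ (suc n) f = trans (fromℤ-+ (ℤΣ.∑≤ n f) (f (suc n))) (+-congʳ (fromℤ-∑≤ n f))

  fromℤ-𝟙 : ∀ {p} {P : Set p} (P? : Dec P) i → fromℤ (ℤΣ.𝟙[ P? ] i) ≈ 𝟙[ P? ] fromℤ i
  fromℤ-𝟙 (yes _) i = refl
  fromℤ-𝟙 (no _) i = refl

  x+y≈z⇒x≈z-y : ∀ {u v w} → u + v ≈ w → u ≈ w - v
  x+y≈z⇒x≈z-y {u} {v} h = trans (solve 2 (λ u v → u := (u :+ v) :- v) refl u v) (+-congʳ h)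

  *-cancelˡ : ∀ {a u v} → ¬ a ≈ 0# → a * u ≈ a * v → u ≈ v
  *-cancelˡ {a} {u} {v} a≉0 au≈av = begin
    u                  ≈⟨ solve 3 (λ a a⁻¹ u → u := a⁻¹ :* (a :* u) :+ (con (+ 1) :- a :* a⁻¹) :* u) refl a (a ⁻¹) u ⟩
    a ⁻¹ * (a * u) + (1# - a * a ⁻¹) * u ≈⟨ +-cong (*-congˡ au≈av) (*-congʳ 1-aa⁻¹≈0) ⟩
    a ⁻¹ * (a * v) + 0# * u              ≈⟨ +-cong (solve 3 (λ a a⁻¹ v → a⁻¹ :* (a :* v) := (a :* a⁻¹) :* v) refl a (a ⁻¹) v) (zeroˡ u) ⟩
    (a * a ⁻¹) * v + 0#                  ≈⟨ trans (+-identityʳ _) (*-congʳ (inverseʳ a a≉0)) ⟩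
    1# * v                               ≈⟨ *-identityˡ v ⟩
    v                                    ∎
    where
    1-aa⁻¹≈0 : 1# - a * a ⁻¹ ≈ 0#
    1-aa⁻¹≈0 = trans (+-congˡ (-‿cong (inverseʳ a a≉0))) (-‿inverseʳ 1#)

  *-≉0 : ∀ {a b} → ¬ a ≈ 0# → ¬ b ≈ 0# → ¬ a * b ≈ 0#
  *-≉0 {a} a≉0 b≉0 ab≈0 = b≉0 (*-cancelˡ a≉0 (trans ab≈0 (sym (zeroʳ a))))

  ⁻¹-cong : ∀ {x y} → x ≈ y → ¬ y ≈ 0# → x ⁻¹ ≈ y ⁻¹
  ⁻¹-cong {x} {y} x≈y y≉0 = *-cancelˡ y≉0 (begin
    y * x ⁻¹ ≈⟨ *-congʳ (sym x≈y) ⟩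
    x * x ⁻¹ ≈⟨ inverseʳ x (y≉0 ∘ trans (sym x≈y)) ⟩
    1#       ≈⟨ sym (inverseʳ y y≉0) ⟩
    y * y ⁻¹ ∎)

  *≈⇒≈÷ : ∀ {a x b} → ¬ a ≈ 0# → a * x ≈ b → x ≈ b ÷ a
  *≈⇒≈÷ {a} {x} {b} a≉0 ax≈b = *-cancelˡ a≉0 (begin
    a * x              ≈⟨ ax≈b ⟩
    b                  ≈⟨ solve 3 (λ a a⁻¹ b → b := b :* (a :* a⁻¹) :+ b :* (con (+ 1) :- a :* a⁻¹)) refl a (a ⁻¹) b ⟩
    b * (a * a ⁻¹) + b * (1# - a * a ⁻¹) ≈⟨ +-cong refl (*-congˡ (trans (+-congˡ (-‿cong (inverseʳ a a≉0))) (-‿inverseʳ 1#))) ⟩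
    b * (a * a ⁻¹) + b * 0#              ≈⟨ trans (+-congˡ (zeroʳ b)) (+-identityʳ _) ⟩
    b * (a * a ⁻¹)                       ≈⟨ solve 3 (λ a a⁻¹ b → b :* (a :* a⁻¹) := a :* (b :* a⁻¹)) refl a (a ⁻¹) b ⟩
    a * (b ÷ a)        ∎)

  1-x≉0 : ∀ {x} → ¬ x ≈ 1# → ¬ 1# - x ≈ 0#
  1-x≉0 {x} x≉1 1-x≈0 = x≉1 (begin
    x             ≈⟨ solve 1 (λ x → x := con (+ 1) :- (con (+ 1) :- x)) refl x ⟩
    1# - (1# - x) ≈⟨ +-congˡ (-‿cong 1-x≈0) ⟩
    1# - 0#       ≈⟨ trans (+-congˡ -0#≈0#) (+-identityʳ 1#) ⟩
    1#            ∎)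

  1^n≈1 : ∀ n → 1# ^ n ≈ 1#
  1^n≈1 zero = refl
  1^n≈1 (suc n) = trans (*-identityˡ _) (1^n≈1 n)

  ^-comm : ∀ x m n → (x ^ m) ^ n ≈ (x ^ n) ^ m
  ^-comm x m n = trans (^-assocʳ x m n) (trans (^-congʳ x (ℕP.*-comm m n)) (sym (^-assocʳ x n m)))

module RootsOfUnity {c ℓ} (F : Field c ℓ) where
  open Field F
  open FieldArithmetic F
  open SetoidReasoning setoid
  open import Algebra.Properties.Ring ring using (-0#≈0#; -‿distribʳ-*)
  open import Algebra.Properties.Semiring.Exp semiring using (^-assocʳ; ^-congˡ; ^-congʳ)

  ρ : Carrier → Carrier
  ρ x = x ÷ ((1# - x) ^ 2)

  ρ-cong : ∀ {x y} → x ≈ y → ¬ y ≈ 1# → ρ x ≈ ρ y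
  ρ-cong {x} {y} x≈y y≉1 = *-cong x≈y (⁻¹-cong (^-congˡ 2 (+-congˡ (-‿cong x≈y))) [1-y]²≉0)
    where
    [1-y]²≉0 : ¬ (1# - y) ^ 2 ≈ 0#
    [1-y]²≉0 = *-≉0 (1-x≉0 y≉1) (1-x≉0 y≉1 ∘ trans (sym (*-identityʳ _)))

  ∑xʲ ∑jxʲ ∑j²xʲ : Carrier → ℕ → Carrier
  ∑xʲ x m = ∑[ j < m ] (x ^ j)
  ∑jxʲ x m = ∑[ j < m ] (fromℕ j * x ^ j)
  ∑j²xʲ x m = ∑[ j < m ] (fromℕ j * fromℕ j * x ^ j)

  ∑xʲ-closed : ∀ x m → (1# - x) * ∑xʲ x m + x ^ m ≈ 1#
  ∑xʲ-closed x zero = solve 1 (λ x → (con (+ 1) :- x) :* con (+ 0) :+ con (+ 1) := con (+ 1)) refl x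
  ∑xʲ-closed x (suc m) = begin
    (1# - x) * (∑xʲ x m + x ^ m) + x * x ^ m
      ≈⟨ solve 3 (λ x a X → (con (+ 1) :- x) :* (a :+ X) :+ x :* X := (con (+ 1) :- x) :* a :+ X) refl x (∑xʲ x m) (x ^ m) ⟩
    (1# - x) * ∑xʲ x m + x ^ m ≈⟨ ∑xʲ-closed x m ⟩
    1# ∎

  ∑jxʲ-closed : ∀ x m → (1# - x) * ∑jxʲ x m + fromℕ m * x ^ m ≈ ∑xʲ x m + x ^ m - 1#
  ∑jxʲ-closed x zero =
    solve 1 (λ x → (con (+ 1) :- x) :* con (+ 0) :+ con (+ 0) :* con (+ 1) := con (+ 0) :+ con (+ 1) :- con (+ 1)) refl x
  ∑jxʲ-closed x (suc m) = begin
    (1# - x) * (∑jxʲ x m + fromℕ m * x ^ m) + (1# + fromℕ m) * (x * x ^ m)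
      ≈⟨ solve 5 (λ x b a M X → (con (+ 1) :- x) :* (b :+ M :* X) :+ (con (+ 1) :+ M) :* (x :* X)
                                := ((con (+ 1) :- x) :* b :+ M :* X) :+ x :* X) refl x (∑jxʲ x m) (∑xʲ x m) (fromℕ m) (x ^ m) ⟩
    ((1# - x) * ∑jxʲ x m + fromℕ m * x ^ m) + x * x ^ m ≈⟨ +-congʳ (∑jxʲ-closed x m) ⟩
    (∑xʲ x m + x ^ m - 1#) + x * x ^ m
      ≈⟨ solve 3 (λ x a X → (a :+ X :- con (+ 1)) :+ x :* X := (a :+ X) :+ x :* X :- con (+ 1)) refl x (∑xʲ x m) (x ^ m) ⟩
    (∑xʲ x m + x ^ m) + x * x ^ m - 1# ∎

  ∑j²xʲ-closed : ∀ x m → (1# - x) * ∑j²xʲ x m + fromℕ m * fromℕ m * x ^ m + x ^ m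
                         ≈ ((2 × 1#) * ∑jxʲ x m - ∑xʲ x m) + 1# + (2 × 1#) * fromℕ m * x ^ m
  ∑j²xʲ-closed x zero = solve 1 (λ x → (con (+ 1) :- x) :* con (+ 0) :+ (con (+ 0) :* con (+ 0)) :* con (+ 1) :+ con (+ 1)
                          := ((con (+ 2) :* con (+ 0) :- con (+ 0)) :+ con (+ 1)) :+ (con (+ 2) :* con (+ 0)) :* con (+ 1)) refl x
  ∑j²xʲ-closed x (suc m) = begin
    (1# - x) * (∑j²xʲ x m + M * M * X) + (1# + M) * (1# + M) * (x * X) + x * X
      ≈⟨ solve 4 (λ x c M X → (con (+ 1) :- x) :* (c :+ (M :* M) :* X) :+ ((con (+ 1) :+ M) :* (con (+ 1) :+ M)) :* (x :* X) :+ x :* X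
            := ((con (+ 1) :- x) :* c :+ (M :* M) :* X :+ X) :+ ((:- X) :+ con (+ 2) :* (x :* X) :+ (con (+ 2) :* M) :* (x :* X)))
            refl x (∑j²xʲ x m) M X ⟩
    ((1# - x) * ∑j²xʲ x m + M * M * X + X) + (- X + (2 × 1#) * (x * X) + (2 × 1#) * M * (x * X))
      ≈⟨ +-congʳ (∑j²xʲ-closed x m) ⟩
    (((2 × 1#) * ∑jxʲ x m - ∑xʲ x m) + 1# + (2 × 1#) * M * X) + (- X + (2 × 1#) * (x * X) + (2 × 1#) * M * (x * X))
      ≈⟨ solve 5 (λ x b a M X → ((con (+ 2) :* b :- a) :+ con (+ 1) :+ (con (+ 2) :* M) :* X) :+ ((:- X) :+ con (+ 2) :* (x :* X) :+ (con (+ 2) :* M) :* (x :* X))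
            := ((con (+ 2) :* (b :+ M :* X) :- (a :+ X)) :+ con (+ 1)) :+ (con (+ 2) :* (con (+ 1) :+ M)) :* (x :* X))
            refl x (∑jxʲ x m) (∑xʲ x m) M X ⟩
    ((2 × 1#) * (∑jxʲ x m + M * X) - (∑xʲ x m + X)) + 1# + (2 × 1#) * (1# + M) * (x * X) ∎
    where
    M X : Carrier
    M = fromℕ m
    X = x ^ m

  module _ {x m} (x^m≈1 : x ^ m ≈ 1#) (x≉1 : ¬ x ≈ 1#) where

    ∑xʲ-root : ∑xʲ x m ≈ 0#
    ∑xʲ-root = *-cancelˡ (1-x≉0 x≉1) (trans (x+y≈z⇒x≈z-y (∑xʲ-closed x m))
                 (trans (+-congˡ (-‿cong x^m≈1)) (trans (-‿inverseʳ 1#) (sym (zeroʳ _)))))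

    [1-x]∑jxʲ-root : (1# - x) * ∑jxʲ x m ≈ - fromℕ m
    [1-x]∑jxʲ-root = trans (x+y≈z⇒x≈z-y (∑jxʲ-closed x m)) (trans (+-cong (+-congʳ (+-cong ∑xʲ-root x^m≈1)) (-‿cong (*-congˡ x^m≈1)))
                       (solve 1 (λ M → (con (+ 0) :+ con (+ 1) :- con (+ 1)) :- M :* con (+ 1) := :- M) refl (fromℕ m)))

    [1-x]∑j²xʲ-root : (1# - x) * ∑j²xʲ x m ≈ (2 × 1#) * ∑jxʲ x m + (2 × 1#) * fromℕ m - fromℕ m * fromℕ m
    [1-x]∑j²xʲ-root = begin
      (1# - x) * ∑j²xʲ x m
        ≈⟨ solve 3 (λ c M X → c := (c :+ (M :* M) :* X :+ X) :- ((M :* M) :* X :+ X)) refl ((1# - x) * ∑j²xʲ x m) M (x ^ m) ⟩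
      ((1# - x) * ∑j²xʲ x m + M * M * x ^ m + x ^ m) - (M * M * x ^ m + x ^ m) ≈⟨ +-congʳ (∑j²xʲ-closed x m) ⟩
      (((2 × 1#) * ∑jxʲ x m - ∑xʲ x m) + 1# + (2 × 1#) * M * x ^ m) - (M * M * x ^ m + x ^ m)
        ≈⟨ +-cong (+-cong (+-congʳ (+-congˡ (-‿cong ∑xʲ-root))) (*-congˡ x^m≈1)) (-‿cong (+-cong (*-congˡ x^m≈1) x^m≈1)) ⟩
      (((2 × 1#) * ∑jxʲ x m - 0#) + 1# + (2 × 1#) * M * 1#) - (M * M * 1# + 1#)
        ≈⟨ solve 2 (λ b M → (((con (+ 2) :* b :- con (+ 0)) :+ con (+ 1)) :+ (con (+ 2) :* M) :* con (+ 1)) :- ((M :* M) :* con (+ 1) :+ con (+ 1))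
             := (con (+ 2) :* b :+ con (+ 2) :* M) :- M :* M) refl (∑jxʲ x m) M ⟩
      (2 × 1#) * ∑jxʲ x m + (2 × 1#) * M - M * M ∎
      where
      M : Carrier
      M = fromℕ m

    -- Both sides times (1 - x)² equal 2 m x, by the two closed forms above.
    ρ-root : (2 × 1#) * fromℕ m * ρ x ≈ fromℕ m * ∑jxʲ x m - ∑j²xʲ x m
    ρ-root = *-cancelˡ Q≉0 (begin
      Q * ((2 × 1#) * M * (x * Q ⁻¹)) ≈⟨ solve 4 (λ q i t x → q :* (t :* (x :* i)) := (t :* x) :* (q :* i)) refl Q (Q ⁻¹) ((2 × 1#) * M) x ⟩
      ((2 × 1#) * M * x) * (Q * Q ⁻¹) ≈⟨ trans (*-congˡ (inverseʳ Q Q≉0)) (*-identityʳ _) ⟩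
      (2 × 1#) * M * x                ≈⟨ sym Q[MB-C]≈2Mx ⟩
      Q * (M * ∑jxʲ x m - ∑j²xʲ x m)  ∎)
      where
      M Q : Carrier
      M = fromℕ m
      Q = (1# - x) ^ 2
      Q≉0 : ¬ Q ≈ 0#
      Q≉0 = *-≉0 (1-x≉0 x≉1) (1-x≉0 x≉1 ∘ trans (sym (*-identityʳ _)))
      Q[MB-C]≈2Mx : Q * (M * ∑jxʲ x m - ∑j²xʲ x m) ≈ (2 × 1#) * M * x
      Q[MB-C]≈2Mx = begin
        Q * (M * ∑jxʲ x m - ∑j²xʲ x m)
          ≈⟨ solve 4 (λ x M b c → ((con (+ 1) :- x) :* ((con (+ 1) :- x) :* con (+ 1))) :* (M :* b :- c)
                 := (con (+ 1) :- x) :* (M :* ((con (+ 1) :- x) :* b) :- (con (+ 1) :- x) :* c)) refl x M (∑jxʲ x m) (∑j²xʲ x m) ⟩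
        (1# - x) * (M * ((1# - x) * ∑jxʲ x m) - (1# - x) * ∑j²xʲ x m)
          ≈⟨ *-congˡ (+-cong (*-congˡ [1-x]∑jxʲ-root) (-‿cong [1-x]∑j²xʲ-root)) ⟩
        (1# - x) * (M * - M - ((2 × 1#) * ∑jxʲ x m + (2 × 1#) * M - M * M))
          ≈⟨ solve 3 (λ x M b → (con (+ 1) :- x) :* (M :* (:- M) :- ((con (+ 2) :* b :+ con (+ 2) :* M) :- M :* M))
                := (:- con (+ 2)) :* ((con (+ 1) :- x) :* b) :- (con (+ 2) :* M) :* (con (+ 1) :- x)) refl x M (∑jxʲ x m) ⟩
        - (2 × 1#) * ((1# - x) * ∑jxʲ x m) - (2 × 1#) * M * (1# - x) ≈⟨ +-congʳ (*-congˡ [1-x]∑jxʲ-root) ⟩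
        - (2 × 1#) * - M - (2 × 1#) * M * (1# - x)
          ≈⟨ solve 2 (λ x M → (:- con (+ 2)) :* (:- M) :- (con (+ 2) :* M) :* (con (+ 1) :- x) := (con (+ 2) :* M) :* x) refl x M ⟩
        (2 × 1#) * M * x ∎

  ∑≤-powers-root : ∀ {y m} → y ^ suc m ≈ 1# → ¬ y ≈ 1# → ∑[1≤ k ≤ m ] (y ^ k) ≈ - 1#
  ∑≤-powers-root {y} {m} y^[1+m]≈1 y≉1 = begin
    ∑≤ m (y ^_)                    ≈⟨ solve 1 (λ s → s := (con (+ 1) :+ s) :- con (+ 1)) refl (∑≤ m (y ^_)) ⟩
    (1# + ∑≤ m (y ^_)) - 1#        ≈⟨ +-congʳ (+-congˡ (∑≤-as-∑< m (y ^_))) ⟩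
    (1# + ∑[ i < m ] (y ^ suc i)) - 1# ≈⟨ +-congʳ (sym (∑<-cons m (y ^_))) ⟩
    ∑xʲ y (suc m) - 1#             ≈⟨ +-congʳ (∑xʲ-root {y} {suc m} y^[1+m]≈1 y≉1) ⟩
    0# - 1#                        ≈⟨ +-identityˡ _ ⟩
    - 1#                           ∎

  ∑j-closed : ∀ m → (2 × 1#) * ∑[ j < m ] fromℕ j + fromℕ m ≈ fromℕ m * fromℕ m
  ∑j-closed zero = solve 0 (con (+ 2) :* con (+ 0) :+ con (+ 0) := con (+ 0) :* con (+ 0)) refl
  ∑j-closed (suc m) = begin
    (2 × 1#) * (∑< m fromℕ + M) + (1# + M)
      ≈⟨ solve 2 (λ s M → con (+ 2) :* (s :+ M) :+ (con (+ 1) :+ M) := (con (+ 2) :* s :+ M) :+ (con (+ 2) :* M :+ con (+ 1))) refl (∑< m fromℕ) M ⟩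
    ((2 × 1#) * ∑< m fromℕ + M) + ((2 × 1#) * M + 1#) ≈⟨ +-congʳ (∑j-closed m) ⟩
    M * M + ((2 × 1#) * M + 1#)
      ≈⟨ solve 1 (λ M → M :* M :+ (con (+ 2) :* M :+ con (+ 1)) := (con (+ 1) :+ M) :* (con (+ 1) :+ M)) refl M ⟩
    (1# + M) * (1# + M) ∎
    where M = fromℕ m

  ∑j²-closed : ∀ m → (6 × 1#) * ∑[ j < m ] (fromℕ j * fromℕ j) + (3 × 1#) * (fromℕ m * fromℕ m)
                     ≈ (2 × 1#) * (fromℕ m * fromℕ m * fromℕ m) + fromℕ m
  ∑j²-closed zero = solve 0 (con (+ 6) :* con (+ 0) :+ con (+ 3) :* (con (+ 0) :* con (+ 0))
                             := con (+ 2) :* (con (+ 0) :* con (+ 0) :* con (+ 0)) :+ con (+ 0)) refl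
  ∑j²-closed (suc m) = begin
    (6 × 1#) * (S + M * M) + (3 × 1#) * ((1# + M) * (1# + M))
      ≈⟨ solve 2 (λ s M → con (+ 6) :* (s :+ M :* M) :+ con (+ 3) :* ((con (+ 1) :+ M) :* (con (+ 1) :+ M))
           := (con (+ 6) :* s :+ con (+ 3) :* (M :* M)) :+ (con (+ 6) :* (M :* M) :+ con (+ 6) :* M :+ con (+ 3))) refl S M ⟩
    ((6 × 1#) * S + (3 × 1#) * (M * M)) + ((6 × 1#) * (M * M) + (6 × 1#) * M + (3 × 1#)) ≈⟨ +-congʳ (∑j²-closed m) ⟩
    ((2 × 1#) * (M * M * M) + M) + ((6 × 1#) * (M * M) + (6 × 1#) * M + (3 × 1#))
      ≈⟨ solve 1 (λ M → (con (+ 2) :* (M :* M :* M) :+ M) :+ (con (+ 6) :* (M :* M) :+ con (+ 6) :* M :+ con (+ 3))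
           := con (+ 2) :* ((con (+ 1) :+ M) :* (con (+ 1) :+ M) :* (con (+ 1) :+ M)) :+ (con (+ 1) :+ M)) refl M ⟩
    (2 × 1#) * ((1# + M) * (1# + M) * (1# + M)) + (1# + M) ∎
    where
    M S : Carrier
    M = fromℕ m
    S = ∑[ j < m ] (fromℕ j * fromℕ j)

  module Primitive {m ω} (ω-primitive : IsPrimitiveRoot (suc m) ω) where

    ω^k-root : ∀ k → (ω ^ k) ^ suc m ≈ 1#
    ω^k-root k = trans (^-comm ω k (suc m)) (trans (^-congˡ k (proj₁ ω-primitive)) (1^n≈1 k))

    ω^k≉1 : ∀ {k} → 1 ≤ k → k ≤ m → ¬ ω ^ k ≈ 1#
    ω^k≉1 1≤k k≤m = proj₂ ω-primitive _ 1≤k (s≤s k≤m)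

    ∑-weighted-powers : ∀ (c : ℕ → Carrier) → c 0 ≈ 0# →
                        ∑[1≤ k ≤ m ] ∑[ j < suc m ] (c j * (ω ^ k) ^ j) ≈ - ∑< (suc m) c
    ∑-weighted-powers c c0≈0 = begin
      ∑[1≤ k ≤ m ] ∑[ j < suc m ] (c j * (ω ^ k) ^ j) ≈⟨ ∑≤-∑<-comm m (suc m) _ ⟩
      ∑[ j < suc m ] ∑[1≤ k ≤ m ] (c j * (ω ^ k) ^ j) ≈⟨ ∑<-cong (suc m) (λ j _ → sym (∑≤-distribˡ m (c j) _)) ⟩
      ∑[ j < suc m ] (c j * ∑[1≤ k ≤ m ] ((ω ^ k) ^ j)) ≈⟨ ∑<-cong (suc m) term ⟩
      ∑[ j < suc m ] (- c j)                           ≈⟨ ∑<-neg (suc m) c ⟩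
      - ∑< (suc m) c                                   ∎
      where
      term : ∀ j → j < suc m → c j * ∑[1≤ k ≤ m ] ((ω ^ k) ^ j) ≈ - c j
      term zero _ = trans (*-congʳ c0≈0) (trans (zeroˡ _) (sym (trans (-‿cong c0≈0) -0#≈0#)))
      term (suc j) (s≤s j<m) = begin
        c (suc j) * ∑[1≤ k ≤ m ] ((ω ^ k) ^ suc j) ≈⟨ *-congˡ (∑≤-cong m (λ k _ _ → ^-comm ω k (suc j))) ⟩
        c (suc j) * ∑[1≤ k ≤ m ] ((ω ^ suc j) ^ k) ≈⟨ *-congˡ (∑≤-powers-root {m = m} (ω^k-root (suc j)) (ω^k≉1 (s≤s z≤n) j<m)) ⟩
        c (suc j) * - 1#                          ≈⟨ solve 1 (λ a → a :* (:- con (+ 1)) := :- a) refl (c (suc j)) ⟩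
        - c (suc j)                               ∎

    ∑ρ-primitive : CharZero → (12 × 1#) * ∑[1≤ k ≤ m ] ρ (ω ^ k) ≈ - (fromℕ (suc m) * fromℕ (suc m) - 1#)
    ∑ρ-primitive charZero = *-cancelˡ (charZero m) (begin
      M * ((12 × 1#) * G)
        ≈⟨ solve 2 (λ M G → M :* (con (+ 12) :* G) := con (+ 6) :* ((con (+ 2) :* M) :* G)) refl M G ⟩
      (6 × 1#) * ((2 × 1#) * M * G) ≈⟨ *-congˡ 2MG≈ ⟩
      (6 × 1#) * (M * - S₁ - - S₂)
        ≈⟨ solve 3 (λ M s₁ s₂ → con (+ 6) :* (M :* (:- s₁) :- (:- s₂))
             := (con (+ 6) :* s₂ :+ con (+ 3) :* (M :* M)) :- (con (+ 3) :* M) :* (con (+ 2) :* s₁ :+ M)) refl M S₁ S₂ ⟩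
      ((6 × 1#) * S₂ + (3 × 1#) * (M * M)) - (3 × 1#) * M * ((2 × 1#) * S₁ + M)
        ≈⟨ +-cong (∑j²-closed (suc m)) (-‿cong (*-congˡ (∑j-closed (suc m)))) ⟩
      ((2 × 1#) * (M * M * M) + M) - (3 × 1#) * M * (M * M)
        ≈⟨ solve 1 (λ M → (con (+ 2) :* (M :* M :* M) :+ M) :- (con (+ 3) :* M) :* (M :* M) := M :* (:- (M :* M :- con (+ 1)))) refl M ⟩
      M * - (M * M - 1#) ∎)
      where
      M G S₁ S₂ : Carrier
      M = fromℕ (suc m)
      G = ∑[1≤ k ≤ m ] ρ (ω ^ k)
      S₁ = ∑< (suc m) fromℕ
      S₂ = ∑[ j < suc m ] (fromℕ j * fromℕ j)
      2MG≈ : (2 × 1#) * M * G ≈ M * - S₁ - - S₂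
      2MG≈ = begin
        (2 × 1#) * M * G                                  ≈⟨ ∑≤-distribˡ m _ _ ⟩
        ∑[1≤ k ≤ m ] ((2 × 1#) * M * ρ (ω ^ k))           ≈⟨ ∑≤-cong m (λ k 1≤k k≤m → ρ-root {m = suc m} (ω^k-root k) (ω^k≉1 1≤k k≤m)) ⟩
        ∑[1≤ k ≤ m ] (M * ∑jxʲ (ω ^ k) (suc m) - ∑j²xʲ (ω ^ k) (suc m)) ≈⟨ ∑≤-distrib-+ m _ _ ⟩
        ∑[1≤ k ≤ m ] (M * ∑jxʲ (ω ^ k) (suc m)) + ∑[1≤ k ≤ m ] (- ∑j²xʲ (ω ^ k) (suc m))
          ≈⟨ +-cong (sym (∑≤-distribˡ m M _)) (∑≤-neg m _) ⟩
        M * ∑[1≤ k ≤ m ] ∑jxʲ (ω ^ k) (suc m) - ∑[1≤ k ≤ m ] ∑j²xʲ (ω ^ k) (suc m)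
          ≈⟨ +-cong (*-congˡ (∑-weighted-powers fromℕ refl)) (-‿cong (∑-weighted-powers (λ j → fromℕ j * fromℕ j) (zeroˡ _))) ⟩
        M * - S₁ - - S₂                                    ∎

  primitive-^ : ∀ {n ζ q e} .{{_ : ℕ.NonZero e}} → IsPrimitiveRoot n ζ → n ≡ q ℕ.* e → IsPrimitiveRoot q (ζ ^ e)
  primitive-^ {n} {ζ} {q} {e} (ζ^n≈1 , ζ^k≉1) n≡qe = ζ^e^q≈1 , ζ^e^k≉1
    where
    ζ^e^q≈1 : (ζ ^ e) ^ q ≈ 1#
    ζ^e^q≈1 = trans (^-assocʳ ζ e q) (trans (^-congʳ ζ (≡.trans (ℕP.*-comm e q) (≡.sym n≡qe))) ζ^n≈1)
    ζ^e^k≉1 : ∀ k → 1 ≤ k → k < q → ¬ (ζ ^ e) ^ k ≈ 1#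
    ζ^e^k≉1 k 1≤k k<q ζ^ek≈1 = ζ^k≉1 (e ℕ.* k) (ℕP.*-mono-≤ (ℕ.>-nonZero⁻¹ e) 1≤k)
      (≡.subst (e ℕ.* k <_) (≡.trans (ℕP.*-comm e q) (≡.sym n≡qe)) (ℕP.*-monoʳ-< e k<q)) (trans (sym (^-assocʳ ζ e k)) ζ^ek≈1)

  fromℤ-𝟙𝟙-* : ∀ {p q} {P : Set p} {Q : Set q} (P? : Dec P) (Q? : Dec Q) i x →
                fromℤ (ℤΣ.𝟙[ P? ] ℤΣ.𝟙[ Q? ] i) * x ≈ 𝟙[ P? ] (fromℤ i * 𝟙[ Q? ] x)
  fromℤ-𝟙𝟙-* (yes _) (yes _) i x = refl
  fromℤ-𝟙𝟙-* (yes _) (no _) i x = trans (zeroˡ x) (sym (zeroʳ _))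
  fromℤ-𝟙𝟙-* (no _) _ i x = zeroˡ x

  ∑-coprime-Möbius : ∀ n .{{_ : ℕ.NonZero n}} (h : ℕ → Carrier) →
    ∑[1≤ k ≤ n ] 𝟙[ gcd n k ℕ.≟ 1 ] h k ≈ ∑[1≤ e ≤ n ] 𝟙[ e ∣? n ] (fromℤ (μ e) * ∑[1≤ k ≤ n ] 𝟙[ e ∣? k ] h k)
  ∑-coprime-Möbius n h = begin
    ∑[1≤ k ≤ n ] 𝟙[ gcd n k ℕ.≟ 1 ] h k
      ≈⟨ ∑≤-cong n (λ k _ _ → 𝟙≈fromℤ𝟙* (gcd n k ℕ.≟ 1) (h k)) ⟩
    ∑[1≤ k ≤ n ] (fromℤ (ℤΣ.𝟙[ gcd n k ℕ.≟ 1 ] (+ 1)) * h k)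
      ≈⟨ ∑≤-cong n (λ k _ _ → *-congʳ (trans (reflexive (≡.cong fromℤ (𝟙-coprime n k))) (fromℤ-∑≤ n _))) ⟩
    ∑[1≤ k ≤ n ] (∑[1≤ e ≤ n ] fromℤ (ℤΣ.𝟙[ e ∣? n ] ℤΣ.𝟙[ e ∣? k ] μ e) * h k)
      ≈⟨ ∑≤-cong n (λ k _ _ → trans (∑≤-distribʳ n (h k) _) (∑≤-cong n (λ e _ _ → fromℤ-𝟙𝟙-* (e ∣? n) (e ∣? k) (μ e) (h k)))) ⟩
    ∑[1≤ k ≤ n ] ∑[1≤ e ≤ n ] 𝟙[ e ∣? n ] (fromℤ (μ e) * 𝟙[ e ∣? k ] h k) ≈⟨ ∑≤-comm n n _ ⟩
    ∑[1≤ e ≤ n ] ∑[1≤ k ≤ n ] 𝟙[ e ∣? n ] (fromℤ (μ e) * 𝟙[ e ∣? k ] h k)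
      ≈⟨ ∑≤-cong n (λ e _ _ → trans (∑≤-𝟙 (e ∣? n) n _) (𝟙-cong (e ∣? n) (λ _ → sym (∑≤-distribˡ n (fromℤ (μ e)) _)))) ⟩
    ∑[1≤ e ≤ n ] 𝟙[ e ∣? n ] (fromℤ (μ e) * ∑[1≤ k ≤ n ] 𝟙[ e ∣? k ] h k) ∎
    where
    𝟙≈fromℤ𝟙* : ∀ {p} {P : Set p} (P? : Dec P) x → 𝟙[ P? ] x ≈ fromℤ (ℤΣ.𝟙[ P? ] (+ 1)) * x
    𝟙≈fromℤ𝟙* (yes _) x = sym (trans (*-congʳ (+-identityʳ 1#)) (*-identityˡ x))
    𝟙≈fromℤ𝟙* (no _) x = sym (zeroˡ x)

  fromℤ-q²-1 : ∀ q → fromℤ (+ (q ℕ.* q) ℤ.- + 1) ≈ fromℕ q * fromℕ q - 1#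
  fromℤ-q²-1 q = trans (fromℤ-+ (+ (q ℕ.* q)) (ℤ.- + 1)) (+-cong (fromℕ-* q q) (-‿cong (+-identityʳ 1#)))

  -fromℤ-J₂ : ∀ n → 2 ≤ n →
              - fromℤ (J₂ n) ≈ ∑[1≤ e ≤ n ] 𝟙[ e ∣? n ] (fromℤ (μ e) * - (fromℕ (quot n e) * fromℕ (quot n e) - 1#))
  -fromℤ-J₂ n 2≤n = begin
    - fromℤ (J₂ n)                                   ≡⟨ ≡.cong (-_ ∘ fromℤ) (J₂-as-∑-μ[q²-1] n 2≤n) ⟩
    - fromℤ (ℤΣ.∑≤ n f)                              ≈⟨ -‿cong (fromℤ-∑≤ n f) ⟩
    - ∑[1≤ e ≤ n ] fromℤ (f e)                       ≈⟨ sym (∑≤-neg n _) ⟩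
    ∑[1≤ e ≤ n ] (- fromℤ (f e))                     ≈⟨ ∑≤-cong n (λ e _ _ → term e) ⟩
    ∑[1≤ e ≤ n ] 𝟙[ e ∣? n ] (fromℤ (μ e) * - (fromℕ (quot n e) * fromℕ (quot n e) - 1#)) ∎
    where
    f : ℕ → ℤ
    f e = ℤΣ.𝟙[ e ∣? n ] (μ e ℤ.* (+ (quot n e ℕ.* quot n e) ℤ.- + 1))
    term : ∀ e → - fromℤ (f e) ≈ 𝟙[ e ∣? n ] (fromℤ (μ e) * - (fromℕ (quot n e) * fromℕ (quot n e) - 1#))
    term e = begin
      - fromℤ (f e)                  ≈⟨ -‿cong (fromℤ-𝟙 (e ∣? n) _) ⟩
      - 𝟙[ e ∣? n ] fromℤ (μ e ℤ.* (+ (q ℕ.* q) ℤ.- + 1)) ≈⟨ sym (𝟙-neg (e ∣? n) _) ⟩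
      𝟙[ e ∣? n ] (- fromℤ (μ e ℤ.* (+ (q ℕ.* q) ℤ.- + 1))) ≈⟨ 𝟙-cong (e ∣? n) (λ _ →
                                          trans (-‿cong (trans (fromℤ-* (μ e) _) (*-congˡ (fromℤ-q²-1 q)))) (-‿distribʳ-* _ _)) ⟩
      𝟙[ e ∣? n ] (fromℤ (μ e) * - (fromℕ q * fromℕ q - 1#)) ∎
      where
      q : ℕ
      q = quot n e

  module AtPrimitiveRoot (charZero : CharZero) {n ζ} (ζ-primitive : IsPrimitiveRoot n ζ) where

    -- ζ ^ n = 1, so the term k = n of the full range is the junk value 1 ÷ 0 and is cut off.
    ρ∘ζ^ : ℕ → Carrier
    ρ∘ζ^ k = 𝟙[ k ℕ.<? n ] ρ (ζ ^ k)

    ∑ρ∘ζ^-multiples : ∀ {e} .{{_ : ℕ.NonZero n}} → e ∣ n →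
                     (12 × 1#) * ∑[1≤ k ≤ n ] 𝟙[ e ∣? k ] ρ∘ζ^ k ≈ - (fromℕ (quot n e) * fromℕ (quot n e) - 1#)
    ∑ρ∘ζ^-multiples {zero} 0∣n = contradiction (0∣⇒≡0 0∣n) (ℕ.≢-nonZero⁻¹ n)
    ∑ρ∘ζ^-multiples {suc _} (divides zero n≡0) = contradiction n≡0 (ℕ.≢-nonZero⁻¹ n)
    ∑ρ∘ζ^-multiples {e@(suc _)} (divides q@(suc q-1) n≡qe) = begin
      (12 × 1#) * ∑[1≤ k ≤ n ] 𝟙[ e ∣? k ] ρ∘ζ^ k          ≡⟨ ≡.cong (λ m → (12 × 1#) * ∑[1≤ k ≤ m ] 𝟙[ e ∣? k ] ρ∘ζ^ k) n≡qe ⟩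
      (12 × 1#) * ∑[1≤ k ≤ q ℕ.* e ] 𝟙[ e ∣? k ] ρ∘ζ^ k    ≈⟨ *-congˡ (∑≤-multiples {e} q ρ∘ζ^) ⟩
      (12 × 1#) * (∑[1≤ j ≤ q-1 ] ρ∘ζ^ (e ℕ.* j) + ρ∘ζ^ (e ℕ.* q))
        ≈⟨ *-congˡ (+-cong (∑≤-cong q-1 nontrivial) (𝟙-no (e ℕ.* q ℕ.<? n) (ℕP.<-irrefl eq≡n))) ⟩
      (12 × 1#) * (∑[1≤ j ≤ q-1 ] ρ (ω ^ j) + 0#)          ≈⟨ *-congˡ (+-identityʳ _) ⟩
      (12 × 1#) * ∑[1≤ j ≤ q-1 ] ρ (ω ^ j)                 ≈⟨ Primitive.∑ρ-primitive ω-primitive charZero ⟩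
      - (fromℕ q * fromℕ q - 1#)                           ≡⟨ ≡.cong (λ m → - (fromℕ m * fromℕ m - 1#)) (≡.sym quot≡q) ⟩
      - (fromℕ (quot n e) * fromℕ (quot n e) - 1#)         ∎
      where
      ω : Carrier
      ω = ζ ^ e
      ω-primitive : IsPrimitiveRoot q ω
      ω-primitive = primitive-^ ζ-primitive n≡qe
      eq≡n : e ℕ.* q ≡ n
      eq≡n = ≡.sym (≡.trans n≡qe (ℕP.*-comm q e))
      quot≡q : quot n e ≡ q
      quot≡q = ≡.trans (≡.cong (λ m → quot m e) n≡qe) (DM.m*n/n≡m q e)
      nontrivial : ∀ j → 1 ≤ j → j ≤ q-1 → ρ∘ζ^ (e ℕ.* j) ≈ ρ (ω ^ j)
      nontrivial j 1≤j j≤q-1 = trans (𝟙-yes (e ℕ.* j ℕ.<? n) (≡.subst (e ℕ.* j <_) eq≡n (ℕP.*-monoʳ-< e (s≤s j≤q-1)))) (ρ-cong (sym (^-assocʳ ζ e j)) (Primitive.ω^k≉1 ω-primitive 1≤j j≤q-1))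

theorem1p1 : ∀ {c ℓ : Level} (F : Field c ℓ) → Field.CharZero F →
    (n : ℕ) → 2 ≤ n → (ζ : Field.Carrier F) → Field.IsPrimitiveRoot F n ζ →
    let open Field F in
    sumL (λ k → (ζ ^ k) ÷ ((1# - ζ ^ k) ^ 2)) (coprimeIndices n)
      ≈ (- fromℤ (J₂ n)) ÷ (12 × 1#)
theorem1p1 F charZero n@(ℕ.suc _) 2≤n ζ ζ-primitive = *≈⇒≈÷ (charZero 11) (begin
  (12 × 1#) * sumL (ρ ∘ (ζ ^_)) (coprimeIndices n)
    ≈⟨ *-congˡ (trans (sumList-filter (λ k → gcd n k ℕ.≟ 1) _ (range1 n)) (sumList-range1 _ n)) ⟩
  (12 × 1#) * ∑[1≤ k ≤ n ] 𝟙[ gcd n k ℕ.≟ 1 ] ρ (ζ ^ k)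
    ≈⟨ *-congˡ (∑≤-cong n (λ k _ k≤n → 𝟙-cong (gcd n k ℕ.≟ 1) (λ coprime → sym (𝟙-yes (k ℕ.<? n) (coprime⇒<n 2≤n k≤n coprime))))) ⟩
  (12 × 1#) * ∑[1≤ k ≤ n ] 𝟙[ gcd n k ℕ.≟ 1 ] ρ∘ζ^ k
    ≈⟨ *-congˡ (∑-coprime-Möbius n ρ∘ζ^) ⟩
  (12 × 1#) * ∑[1≤ e ≤ n ] 𝟙[ e ∣? n ] (fromℤ (μ e) * ∑[1≤ k ≤ n ] 𝟙[ e ∣? k ] ρ∘ζ^ k)
    ≈⟨ trans (∑≤-distribˡ n _ _) (∑≤-cong n (λ e _ _ → trans (𝟙-distribˡ (e ∣? n) _ _) (𝟙-cong (e ∣? n) (λ e∣n →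
         trans (x∙yz≈y∙xz _ _ _) (*-congˡ (∑ρ∘ζ^-multiples e∣n)))))) ⟩
  ∑[1≤ e ≤ n ] 𝟙[ e ∣? n ] (fromℤ (μ e) * - (fromℕ (quot n e) * fromℕ (quot n e) - 1#))
    ≈⟨ sym (-fromℤ-J₂ n 2≤n) ⟩
  - fromℤ (J₂ n) ∎)
  where
  open Field F
  open FieldArithmetic F
  open RootsOfUnity F
  open SetoidReasoning setoid
  open CommSemigroupProperties *-commutativeSemigroup using (x∙yz≈y∙xz)
  open RootsOfUnity.AtPrimitiveRoot F charZero ζ-primitive
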